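{- For $n\ge0$ let $c_n=m_4(\mathrm{Im}\mathcal B_2(n))$. Then: (a) $\displaystyle\sum_{n\ge0}c_nq^n=\frac{q^4(1+q+2q^2)}{(1-q^2)(1-q^4)}\prod_{i\ge0}\frac1{1-q^{2^i}}$. (b) For $n\ge0$, $c_n=\sum_{i\ge2}(i-1)|\mathcal B(n-2i)|+\sum_{i\ge4}\left\lceil\frac{i-4}{4}\right\rceil|\mathcal B(n-i)|$. (c) For $n\ge0$, $\Delta c_n=|\mathcal{BR}_4(n)|+\delta(n\text{ odd})\,|\mathcal{BR}_2(n)|$.
   Context: A binary partition is a partition (weakly decreasing sequence of positive integers) all of whose parts are powers of $2$ (including $1$). $\mathcal B(n)$ is the set of binary partitions of $n$, with $\mathcal B(0)=\{\text{empty partition}\}$ and $\mathcal B(n)=\emptyset$ for $n<0$; $\mathcal B_2(n)$ is the set of those with at least two parts. For a partition $\lambda=(\lambda_1,\dots,\lambda_\ell)$ with $\ell\ge2$, $\mathrm{pre}_2(\lambda)$ is the partition whose parts are the products $\lambda_i\lambda_j$, $1\le i<j\le\ell$. $\mathrm{Im}\mathcal B_2(n)=\{\mathrm{pre}_2(\lambda):\lambda\in\mathcal B_2(n)\}$. $m_i(\mu)$ is the number of parts equal to $i$ in $\mu$ and, for a set $S$ of partitions, $m_i(S)=\sum_{\mu\in S}m_i(\mu)$. $\mathcal{BR}_i(n)$ is the set of binary partitions of $n$ with a single rooted (marked) part equal to $i$, i.e. pairs $(\lambda,p)$ with $\lambda\in\mathcal B(n)$ and $p$ a position with $\lambda_p=i$;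 thus $|\mathcal{BR}_i(n)|=\sum_{\lambda\in\mathcal B(n)}m_i(\lambda)$. $\delta(S)$ is $1$ if $S$ is true and $0$ otherwise. $\Delta c_n=c_{n+1}-c_n$. -}

module Defs where

open import Data.Nat using (ℕ; zero; suc; _+_; _*_; _∸_; _^_; _≤ᵇ_; _≡ᵇ_; _⊓_; _/_)
open import Data.Bool using (Bool; true; false; if_then_else_)
open import Data.List using (List; []; _∷_; map; concatMap; filter; length; upTo; deduplicate; applyUpTo; zip; _++_; foldr)
open import Data.List.Properties using (≡-dec)
open import Data.Nat.Properties using (_≟_)
open import Data.Fin using (Fin; toℕ)
open import Data.Product using (Σ; _×_; _,_)
open import Data.Nat.ListAction using (sum)
open import Data.Bool.ListAction using (any; all)

-- Partitions are represented as weakly decreasing lists of positive ℕ.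

-- Partitions of n with all parts ≤ m (fuel f ≥ n guarantees termination).
partsLE : ℕ → ℕ → ℕ → List (List ℕ)
partsLE zero    zero    m = [] ∷ []
partsLE zero    (suc n) m = []
partsLE (suc f) zero    m = [] ∷ []
partsLE (suc f) (suc n) m =
  concatMap (λ k → map (k ∷_) (partsLE f (suc n ∸ k) k))
            (applyUpTo suc (suc n ⊓ m))

allPartitions : ℕ → List (List ℕ)
allPartitions n = partsLE n n n

-- x is a power of 2 (including 2^0 = 1); bounded search suffices since 2^k > x for k > x.
isPow2 : ℕ → Bool
isPow2 x = any (λ k → (2 ^ k) ≡ᵇ x) (upTo (suc x))

B : ℕ → List (List ℕ)
B n = filter (λ λ' → Data.Bool.T? (all isPow2 λ')) (allPartitions n)
  where import Data.Bool

Bshift : ℕ → ℕ → ℕ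
Bshift n k = if k ≤ᵇ n then length (B (n ∸ k)) else 0

B₂ : ℕ → List (List ℕ)
B₂ n = filter (λ λ' → Data.Bool.T? (2 ≤ᵇ length λ')) (B n)
  where import Data.Bool

insertD : ℕ → List ℕ → List ℕ
insertD x []       = x ∷ []
insertD x (y ∷ ys) = if y ≤ᵇ x then x ∷ y ∷ ys else y ∷ insertD x ys

sortD : List ℕ → List ℕ
sortD = foldr insertD []

pairProducts : List ℕ → List ℕ
pairProducts []       = []
pairProducts (x ∷ xs) = map (x *_) xs ++ pairProducts xs

pre₂ : List ℕ → List ℕ
pre₂ λ' = sortD (pairProducts λ')

-- Im 𝓑₂(n) as a SET (duplicates removed)
ImB₂ : ℕ → List (List ℕ)
ImB₂ n = deduplicate (≡-dec _≟_) (map pre₂ (B₂ n))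

mult : ℕ → List ℕ → ℕ
mult i μ = length (filter (λ x → x ≟ i) μ)

multSet : ℕ → List (List ℕ) → ℕ
multSet i S = sum (map (mult i) S)

c : ℕ → ℕ
c n = multSet 4 (ImB₂ n)

-- 𝓑𝓡ᵢ(n): pairs (λ, p) with λ ∈ 𝓑(n) and p a position with λ_p = i
positions : ℕ → List ℕ → List ℕ
positions i λ' = map (λ (p , _) → p) (filter (λ (_ , x) → x ≟ i) (zip (upTo (length λ')) λ'))

BR : ℕ → ℕ → List (List ℕ × ℕ)
BR i n = concatMap (λ λ' → map (λ p → (λ' , p)) (positions i λ')) (B n)

-- Formal power series with ℕ coefficients: ℕ → ℕ (coefficient of q^n).

Series : Set
Series = ℕ → ℕ

_⊛_ : Series → Series → Series
(f ⊛ g) n = sum (map (λ i → f i * g (n ∸ i)) (upTo (suc n)))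

infixl 7 _⊛_

one : Series
one zero    = 1
one (suc _) = 0

-- 1 / (1 - q^k) for k ≥ 1 : coefficient of q^n is 1 if k ∣ n, else 0
divides? : ℕ → ℕ → Bool
divides? k n = any (λ j → (j * k) ≡ᵇ n) (upTo (suc n))

geom : ℕ → Series
geom k n = if divides? k n then 1 else 0

prodGeom : ℕ → Series
prodGeom zero    = one
prodGeom (suc N) = prodGeom N ⊛ geom (2 ^ N)

-- ∏_{i ≥ 0} 1/(1 - q^{2^i}): the coefficient of q^n is that of any truncation
-- ∏_{i < N} with 2^N > n; we take N = n + 1.
prodBinary : Series
prodBinary n = prodGeom (suc n) n

-- the polynomial q^4 (1 + q + 2 q^2) = q^4 + q^5 + 2 q^6
numer : Series
numer n = if n ≡ᵇ 4 then 1 else if n ≡ᵇ 5 then 1 else if n ≡ᵇ 6 then 2 else 0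

cSeries : Series
cSeries = c

rhsA : Series
rhsA = numer ⊛ geom 2 ⊛ geom 4 ⊛ prodBinary

-- ⌈(i - 4)/4⌉ for i ≥ 4
ceilQuarter : ℕ → ℕ
ceilQuarter i = ((i ∸ 4) + 3) / 4

-- right-hand side of (b); terms with 2i > n (resp. i > n) vanish, so summing
-- i over 0..n with the lower bounds imposed is the full infinite sum.
rhsB : ℕ → ℕ
rhsB n = sum (map (λ i → if 2 ≤ᵇ i then (i ∸ 1) * Bshift n (2 * i) else 0) (upTo (suc n)))
       + sum (map (λ i → if 4 ≤ᵇ i then ceilQuarter i * Bshift n i else 0) (upTo (suc n)))

isOdd : ℕ → Bool
isOdd n = (n Data.Nat.% 2) ≡ᵇ 1
  where import Data.Nat

δ : Bool → ℕ
δ true  = 1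
δ false = 0

module Submission where

-- Inserting a part i = 2ᵏ is a bijection from 𝓑(n) onto the binary partitions of n + i having
-- a part i, which turns sums over 𝓑(n + i) into sums over 𝓑(n) and yields linear recurrences.
-- pre₂ is injective on 𝓑(n): the identity pₖ(λ)² = p₂ₖ(λ) + 2 pₖ(pre₂ λ) recovers every power
-- sum p_{2ʲ}(λ) from p₁(λ) = n and pre₂ λ, and a single large power sum determines λ.  As the only
-- products of powers of 2 equal to 4 are 1·4 and 2·2, c n = Σ_{λ ∈ 𝓑(n)} (m₁ m₄ + C(m₂, 2))(λ).
-- The two summands satisfy recurrences of period 4 and 2 driven by m₁(𝓑(n)) and m₂(𝓑(n)), as do
-- the two sums in (b), which gives (b).  The coefficient of qⁿ in the infinite product is |𝓑(n)|,
-- and the coefficients of q⁴(1 + q + 2q²)/((1 − q²)(1 − q⁴)) are the combined weights of (b),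
-- which gives (a).  Shifting the recurrences by one step gives (c).

open import Defs
open import Function using (_∘_; _$_)
open import Data.Nat
open import Data.Nat.Properties
open import Data.Nat.Combinatorics using (_C_; nC1≡n; nCk+nC[k+1]≡[n+1]C[k+1])
open import Data.Nat.Divisibility using (_∣_; divides; _∣?_; ∣⇒≤; ∣m∣n⇒∣m+n; ∣m+n∣m⇒∣n; ∣-refl; n∣m⇒m%n≡0; m%n≡0⇒n∣m)
open import Data.Nat.Induction using (<-rec)
open import Data.Nat.DivMod using (m/n≡1+[m∸n]/n; _%_; m%n<n; [m+n]%n≡m%n)
open import Data.Nat.ListAction using (sum)
open import Data.Bool using (Bool; true; false; if_then_else_; T; T?)
open import Data.Unit using (⊤; tt)
open import Data.List using (List; []; _∷_; _++_; map; upTo; applyUpTo; concatMap; filter; length; deduplicate; zip)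
open import Data.Bool.ListAction using (any; all)
open import Data.List.Membership.Propositional using (_∈_; _∉_; find; lose)
open import Data.List.Membership.Propositional.Properties
  using (∈-upTo⁺; ∈-upTo⁻; ∈-map⁺; ∈-map⁻; ∈-concatMap⁺; ∈-concatMap⁻; ∈-applyUpTo⁺; ∈-applyUpTo⁻; ∈-filter⁺; ∈-filter⁻; ∈-deduplicate⁺; ∈-deduplicate⁻)
open import Data.List.Properties using (∷-injectiveʳ; map-∘; map-cong-local; filter-accept; filter-reject; filter-++; length-++; map-++; ≡-dec; length-map; length-upTo)
open import Data.List.Relation.Unary.All as All using (All; []; _∷_)
open import Data.List.Relation.Unary.All.Properties as All using (all⁺; all⁻)
open import Data.List.Relation.Unary.Any using (here; there)
open import Data.List.Relation.Unary.Any.Properties using (any⁺; any⁻)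
open import Data.List.Relation.Unary.Unique.Propositional using (Unique)
open import Data.List.Relation.Unary.AllPairs using ([]; _∷_)
import Data.List.Relation.Unary.Unique.Propositional.Properties as Unique
import Data.List.Relation.Unary.Unique.DecPropositional.Properties as DecUnique
open import Data.List.Relation.Binary.Permutation.Propositional using (_↭_; ↭-refl; ↭-trans; ↭-sym; prep; swap)
import Data.List.Relation.Binary.Permutation.Propositional.Properties as ↭
open import Data.List.Relation.Binary.BagAndSetEquality using (∼bag⇒↭)
open import Data.List.Membership.Propositional.Properties.WithK using (unique∧set⇒bag)
open import Data.List.Membership.DecPropositional _≟_ using (_∈?_)
open import Data.Nat.ListAction.Properties using (sum-↭; sum-++)
open import Function.Bundles using (mk⇔)
open import Data.Product using (∃-syntax; _×_; _,_; proj₁; proj₂)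
open import Data.Empty using (⊥; ⊥-elim)
open import Data.Sum using (inj₁; inj₂)
open import Relation.Nullary using (¬_; yes; no; Dec)
open import Relation.Nullary.Decidable using (¬?; does; does-⇔; dec-true; dec-false)
open import Relation.Binary.Definitions using (tri<; tri≈; tri>; DecidableEquality)
open import Relation.Binary.PropositionalEquality
open import Data.Nat.Tactic.RingSolver using (solve-∀)
open import Algebra.Properties.CommutativeSemigroup +-commutativeSemigroup
  using () renaming (interchange to +-interchange; x∙yz≈y∙xz to +-exchange; x∙yz≈y∙zx to +-rotate)
open import Algebra.Properties.CommutativeSemigroup *-commutativeSemigroup
  using () renaming (interchange to *-interchange)
open ≡-Reasoning

∑< : ℕ → (ℕ → ℕ) → ℕ
∑< zero    f = 0
∑< (suc n) f = f 0 + ∑< n (f ∘ suc)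

infix 5 ∑<
syntax ∑< n (λ i → e) = ∑[ i < n ] e

sum-map-applyUpTo : ∀ (f g : ℕ → ℕ) n → sum (map f (applyUpTo g n)) ≡ ∑< n (f ∘ g)
sum-map-applyUpTo f g zero    = refl
sum-map-applyUpTo f g (suc n) = cong (f (g 0) +_) (sum-map-applyUpTo f (g ∘ suc) n)

sum-map-upTo : ∀ (f : ℕ → ℕ) n → sum (map f (upTo n)) ≡ ∑< n f
sum-map-upTo f = sum-map-applyUpTo f (λ i → i)

∑<-cong : ∀ n {f g} → (∀ {i} → i < n → f i ≡ g i) → ∑< n f ≡ ∑< n g
∑<-cong zero    f≡g = refl
∑<-cong (suc n) f≡g = cong₂ _+_ (f≡g z<s) (∑<-cong n (f≡g ∘ s<s))

∑<-zero : ∀ n {f} → (∀ {i} → i < n → f i ≡ 0) → ∑< n f ≡ 0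
∑<-zero zero    f≡0 = refl
∑<-zero (suc n) f≡0 = cong₂ _+_ (f≡0 z<s) (∑<-zero n (f≡0 ∘ s<s))

∑<-+ : ∀ n f g → ∑[ i < n ] (f i + g i) ≡ ∑< n f + ∑< n g
∑<-+ zero    f g = refl
∑<-+ (suc n) f g = begin
  f 0 + g 0 + (∑[ i < n ] (f (suc i) + g (suc i)))  ≡⟨ cong (f 0 + g 0 +_) (∑<-+ n (f ∘ suc) (g ∘ suc)) ⟩
  f 0 + g 0 + (∑< n (f ∘ suc) + ∑< n (g ∘ suc))     ≡⟨ +-interchange (f 0) (g 0) _ _ ⟩
  f 0 + ∑< n (f ∘ suc) + (g 0 + ∑< n (g ∘ suc))     ∎

∑<-split : ∀ m n f → ∑< (m + n) f ≡ ∑< m f + (∑[ i < n ] f (m + i))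
∑<-split zero    n f = refl
∑<-split (suc m) n f = trans (cong (f 0 +_) (∑<-split m n (f ∘ suc))) (sym (+-assoc (f 0) _ _))

∑<-suc : ∀ n f → ∑< (suc n) f ≡ ∑< n f + f n
∑<-suc n f = begin
  ∑< (suc n) f              ≡⟨ cong (λ m → ∑< m f) (+-comm 1 n) ⟩
  ∑< (n + 1) f              ≡⟨ ∑<-split n 1 f ⟩
  ∑< n f + (f (n + 0) + 0)  ≡⟨ cong (λ x → ∑< n f + x) (trans (+-identityʳ _) (cong f (+-identityʳ n))) ⟩
  ∑< n f + f n              ∎

∑<-truncate : ∀ {m n} f → m ≤ n → (∀ {i} → m ≤ i → f i ≡ 0) → ∑< n f ≡ ∑< m f
∑<-truncate {m} {n} f m≤n f≡0 = begin
  ∑< n f                                  ≡⟨ cong (λ k → ∑< k f) (sym (m+[n∸m]≡n m≤n)) ⟩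
  ∑< (m + (n ∸ m)) f                      ≡⟨ ∑<-split m (n ∸ m) f ⟩
  ∑< m f + (∑[ i < n ∸ m ] f (m + i))     ≡⟨ cong (∑< m f +_) (∑<-zero (n ∸ m) (λ {i} _ → f≡0 (m≤m+n m i))) ⟩
  ∑< m f + 0                              ≡⟨ +-identityʳ _ ⟩
  ∑< m f                                  ∎

sum-map-cong : ∀ {A : Set} {F G : A → ℕ} xs → (∀ {z} → z ∈ xs → F z ≡ G z) → sum (map F xs) ≡ sum (map G xs)
sum-map-cong xs F≡G = cong sum (map-cong-local (All.tabulate F≡G))

sum-map-zero : ∀ {A : Set} {F : A → ℕ} xs → (∀ {z} → z ∈ xs → F z ≡ 0) → sum (map F xs) ≡ 0
sum-map-zero []       F≡0 = refl
sum-map-zero (x ∷ xs) F≡0 = cong₂ _+_ (F≡0 (here refl)) (sum-map-zero xs (F≡0 ∘ there))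

sum-map-+ : ∀ {A : Set} (F G : A → ℕ) xs → sum (map (λ z → F z + G z) xs) ≡ sum (map F xs) + sum (map G xs)
sum-map-+ F G []       = refl
sum-map-+ F G (x ∷ xs) = trans (cong (F x + G x +_) (sum-map-+ F G xs)) (+-interchange (F x) (G x) _ _)

sum-map-const-1 : ∀ {A : Set} (xs : List A) → sum (map (λ _ → 1) xs) ≡ length xs
sum-map-const-1 []       = refl
sum-map-const-1 (x ∷ xs) = cong suc (sum-map-const-1 xs)

sum-map-filter : ∀ {A : Set} {P : A → Set} (P? : ∀ x → Dec (P x)) (F : A → ℕ) xs →
                 sum (map F xs) ≡ sum (map F (filter P? xs)) + sum (map F (filter (¬? ∘ P?) xs))
sum-map-filter P? F []       = refl
sum-map-filter P? F (x ∷ xs) with P? x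
... | yes _ = trans (cong (F x +_) (sum-map-filter P? F xs)) (sym (+-assoc (F x) _ _))
... | no  _ = trans (cong (F x +_) (sum-map-filter P? F xs)) (+-exchange (F x) (sum (map F (filter P? xs))) _)

sum-map-filter-vanishing : ∀ {A : Set} {P : A → Set} (P? : ∀ x → Dec (P x)) (F : A → ℕ) xs →
                           (∀ {z} → z ∈ xs → ¬ P z → F z ≡ 0) → sum (map F xs) ≡ sum (map F (filter P? xs))
sum-map-filter-vanishing P? F xs F≡0 = begin
  sum (map F xs)                                                   ≡⟨ sum-map-filter P? F xs ⟩
  sum (map F (filter P? xs)) + sum (map F (filter (¬? ∘ P?) xs))   ≡⟨ cong (sum (map F (filter P? xs)) +_) (sum-map-zero _ F∌≡0) ⟩
  sum (map F (filter P? xs)) + 0                                   ≡⟨ +-identityʳ _ ⟩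
  sum (map F (filter P? xs))                                       ∎
  where
  F∌≡0 : ∀ {z} → z ∈ filter (¬? ∘ P?) xs → F z ≡ 0
  F∌≡0 z∈ = let z∈xs , ¬Pz = ∈-filter⁻ (¬? ∘ P?) {xs = xs} z∈ in F≡0 z∈xs ¬Pz

sum-map-unique-∈⇔ : ∀ {A : Set} (F : A → ℕ) {xs ys} → Unique xs → Unique ys →
                    (∀ {z} → z ∈ xs → z ∈ ys) → (∀ {z} → z ∈ ys → z ∈ xs) →
                    sum (map F xs) ≡ sum (map F ys)
sum-map-unique-∈⇔ F uxs uys xs⊆ys ys⊆xs = sum-↭ (↭.map⁺ F (∼bag⇒↭ (unique∧set⇒bag uxs uys (mk⇔ xs⊆ys ys⊆xs))))

Unique-map⁺ : ∀ {A C : Set} {f : A → C} {xs} → (∀ {x y} → x ∈ xs → y ∈ xs → f x ≡ f y → x ≡ y) →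
              Unique xs → Unique (map f xs)
Unique-map⁺ {xs = []}     _   []           = []
Unique-map⁺ {xs = x ∷ xs} inj (x∉xs ∷ uxs) =
  All.map⁺ (All.tabulate (λ y∈xs fx≡fy → All.lookup x∉xs y∈xs (inj (here refl) (there y∈xs) fx≡fy)))
  ∷ Unique-map⁺ (λ x∈ y∈ → inj (there x∈) (there y∈)) uxs

sum-map-deduplicate : ∀ {A : Set} (_≟ᴬ_ : DecidableEquality A) (F : A → ℕ) {xs} → Unique xs →
                      sum (map F (deduplicate _≟ᴬ_ xs)) ≡ sum (map F xs)
sum-map-deduplicate _≟ᴬ_ F {xs} uxs = sum-map-unique-∈⇔ F (DecUnique.deduplicate-! _≟ᴬ_ xs) uxs
  (∈-deduplicate⁻ _≟ᴬ_ xs) (∈-deduplicate⁺ _≟ᴬ_)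

*-distrib-^ : ∀ x y k → (x * y) ^ k ≡ x ^ k * y ^ k
*-distrib-^ x y zero    = refl
*-distrib-^ x y (suc k) = trans (cong (x * y *_) (*-distrib-^ x y k)) (*-interchange x y (x ^ k) (y ^ k))

if-then-* : ∀ p x y → (if p then x * y else 0) ≡ (if p then x else 0) * y
if-then-* true  x y = refl
if-then-* false x y = refl

-- Recurrences and geometric series

recurrence-unique : ∀ k .{{_ : NonZero k}} {f g r : ℕ → ℕ} →
                    (∀ {n} → n < k → f n ≡ g n) →
                    (∀ n → f (k + n) ≡ f n + r n) → (∀ n → g (k + n) ≡ g n + r n) →
                    ∀ n → f n ≡ g n
recurrence-unique k {f} {g} {r} initial f-rec g-rec = <-rec _ step
  where
  step : ∀ n → (∀ {m} → m < n → f m ≡ g m) → f n ≡ g n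
  step n ih with n <? k
  ... | yes n<k = initial n<k
  ... | no n≮k = begin
    f n          ≡⟨ cong f (sym k+m≡n) ⟩
    f (k + m)    ≡⟨ f-rec m ⟩
    f m + r m    ≡⟨ cong (_+ r m) (ih m<n) ⟩
    g m + r m    ≡⟨ g-rec m ⟨
    g (k + m)    ≡⟨ cong g k+m≡n ⟩
    g n          ∎
    where
    m = n ∸ k
    k+m≡n : k + m ≡ n
    k+m≡n = m+[n∸m]≡n (≮⇒≥ n≮k)
    m<n : m < n
    m<n = subst (m <_) k+m≡n (m<n+m m (>-nonZero⁻¹ k))

T-any-upTo⁻ : ∀ (p : ℕ → Bool) n → T (any p (upTo n)) → ∃[ j ] j < n × T (p j)
T-any-upTo⁻ p n t with find (any⁻ p (upTo n) t)
... | j , j∈ , pj = j , ∈-upTo⁻ j∈ , pj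

T-any-upTo⁺ : ∀ (p : ℕ → Bool) {n j} → j < n → T (p j) → T (any p (upTo n))
T-any-upTo⁺ p j<n pj = any⁺ p (lose (∈-upTo⁺ j<n) pj)

T-divides?⁻ : ∀ k n → T (divides? k n) → k ∣ n
T-divides?⁻ k n t with T-any-upTo⁻ (λ j → j * k ≡ᵇ n) (suc n) t
... | q , _ , q*k≡n = divides q (sym (≡ᵇ⇒≡ (q * k) n q*k≡n))

T-divides?⁺ : ∀ k .{{_ : NonZero k}} n → k ∣ n → T (divides? k n)
T-divides?⁺ k n (divides q n≡q*k) =
  T-any-upTo⁺ (λ j → j * k ≡ᵇ n) (s≤s (subst (q ≤_) (sym n≡q*k) (m≤m*n q k))) (≡⇒≡ᵇ (q * k) n (sym n≡q*k))

geom-∣ : ∀ k .{{_ : NonZero k}} {n} → k ∣ n → geom k n ≡ 1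
geom-∣ k {n} k∣n with divides? k n in eq
... | true  = refl
... | false = ⊥-elim (subst T eq (T-divides?⁺ k n k∣n))

geom-∤ : ∀ k {n} → ¬ k ∣ n → geom k n ≡ 0
geom-∤ k {n} k∤n with divides? k n in eq
... | false = refl
... | true  = ⊥-elim (k∤n (T-divides?⁻ k n (subst T (sym eq) _)))

geom-+ : ∀ k .{{_ : NonZero k}} n → geom k (k + n) ≡ geom k n
geom-+ k n with k ∣? n
... | yes k∣n = trans (geom-∣ k (∣m∣n⇒∣m+n ∣-refl k∣n)) (sym (geom-∣ k k∣n))
... | no  k∤n = trans (geom-∤ k (λ k∣k+n → k∤n (∣m+n∣m⇒∣n k∣k+n ∣-refl))) (sym (geom-∤ k k∤n))

geom-< : ∀ k {n} → 0 < n → n < k → geom k n ≡ 0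
geom-< k {n} 0<n n<k = geom-∤ k (λ k∣n → <⇒≱ n<k (∣⇒≤ {{>-nonZero 0<n}} k∣n))

⊛-∑ : ∀ f g n → (f ⊛ g) n ≡ ∑[ i < suc n ] f i * g (n ∸ i)
⊛-∑ f g n = sum-map-upTo (λ i → f i * g (n ∸ i)) (suc n)

⊛-congˡ : ∀ {f f′} g → (∀ i → f i ≡ f′ i) → ∀ n → (f ⊛ g) n ≡ (f′ ⊛ g) n
⊛-congˡ {f} {f′} g f≡f′ n = begin
  (f ⊛ g) n                              ≡⟨ ⊛-∑ f g n ⟩
  ∑[ i < suc n ] f i * g (n ∸ i)         ≡⟨ ∑<-cong (suc n) (λ {i} _ → cong (_* g (n ∸ i)) (f≡f′ i)) ⟩
  ∑[ i < suc n ] f′ i * g (n ∸ i)        ≡⟨ ⊛-∑ f′ g n ⟨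
  (f′ ⊛ g) n                             ∎

⊛-geom-< : ∀ f k {n} → n < k → (f ⊛ geom k) n ≡ f n
⊛-geom-< f k {n} n<k = begin
  (f ⊛ geom k) n              ≡⟨ ⊛-∑ f (geom k) n ⟩
  ∑< (suc n) h                ≡⟨ ∑<-suc n h ⟩
  ∑< n h + h n                ≡⟨ cong (_+ h n) (∑<-zero n h≡0) ⟩
  f n * geom k (n ∸ n)        ≡⟨ cong (λ m → f n * geom k m) (n∸n≡0 n) ⟩
  f n * 1                     ≡⟨ *-identityʳ (f n) ⟩
  f n                         ∎
  where
  h : ℕ → ℕ
  h i = f i * geom k (n ∸ i)
  h≡0 : ∀ {i} → i < n → h i ≡ 0
  h≡0 {i} i<n = trans (cong (f i *_) (geom-< k (m<n⇒0<n∸m i<n) (≤-<-trans (m∸n≤m n i) n<k))) (*-zeroʳ (f i))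

⊛-geom-+ : ∀ f k .{{_ : NonZero k}} n → (f ⊛ geom k) (k + n) ≡ (f ⊛ geom k) n + f (k + n)
⊛-geom-+ f k@(suc k′) n = begin
  (f ⊛ geom k) (k + n)                                  ≡⟨ ⊛-∑ f (geom k) (k + n) ⟩
  ∑< (suc (k + n)) h                                    ≡⟨ cong (λ m → ∑< m h) (cong suc (+-comm k n)) ⟩
  ∑< (suc n + k) h                                      ≡⟨ ∑<-split (suc n) k h ⟩
  ∑< (suc n) h + (∑[ j < k ] h (suc n + j))             ≡⟨ cong₂ _+_ lower upper ⟩
  (f ⊛ geom k) n + f (k + n)                            ∎
  where
  h : ℕ → ℕ
  h i = f i * geom k (k + n ∸ i)
  lower : ∑< (suc n) h ≡ (f ⊛ geom k) n
  lower = begin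
    ∑< (suc n) h                        ≡⟨ ∑<-cong (suc n) (λ {i} i<1+n → cong (λ m → f i * geom k m)
                                             (+-∸-assoc k (s≤s⁻¹ i<1+n))) ⟩
    ∑[ i < suc n ] f i * geom k (k + (n ∸ i))
                                        ≡⟨ ∑<-cong (suc n) (λ {i} _ → cong (f i *_) (geom-+ k (n ∸ i))) ⟩
    ∑[ i < suc n ] f i * geom k (n ∸ i) ≡⟨ ⊛-∑ f (geom k) n ⟨
    (f ⊛ geom k) n                      ∎
  offset : ∀ j → k + n ∸ (suc n + j) ≡ k′ ∸ j
  offset j = trans (cong (_∸ (suc n + j)) (cong suc (+-comm k′ n))) ([m+n]∸[m+o]≡n∸o (suc n) k′ j)
  upper : ∑[ j < k ] h (suc n + j) ≡ f (k + n)
  upper = begin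
    ∑[ j < k ] h (suc n + j)                      ≡⟨ ∑<-suc k′ (λ j → h (suc n + j)) ⟩
    (∑[ j < k′ ] h (suc n + j)) + h (suc n + k′)  ≡⟨ cong₂ _+_ (∑<-zero k′ vanish) top ⟩
    f (k + n)                                     ∎
    where
    vanish : ∀ {j} → j < k′ → h (suc n + j) ≡ 0
    vanish {j} j<k′ = trans (cong (λ m → f (suc n + j) * geom k m) (offset j))
      (trans (cong (f (suc n + j) *_) (geom-< k (m<n⇒0<n∸m j<k′) (s≤s (m∸n≤m k′ j)))) (*-zeroʳ (f (suc n + j))))
    top : h (suc n + k′) ≡ f (k + n)
    top = begin
      f (suc n + k′) * geom k (k + n ∸ (suc n + k′))  ≡⟨ cong (λ m → f (suc n + k′) * geom k m) (trans (offset k′) (n∸n≡0 k′)) ⟩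
      f (suc n + k′) * 1                             ≡⟨ *-identityʳ _ ⟩
      f (suc n + k′)                                 ≡⟨ cong (f ∘ suc) (+-comm n k′) ⟩
      f (k + n)                                      ∎

-- Binary partitions

Pow2 : ℕ → Set
Pow2 x = ∃[ k ] 2 ^ k ≡ x

n<2^n : ∀ n → n < 2 ^ n
n<2^n zero    = z<s
n<2^n (suc n) = +-mono-≤-< (m^n>0 2 n) (subst (n <_) (sym (+-identityʳ (2 ^ n))) (n<2^n n))

2^-cancel-< : ∀ a c → 2 ^ a < 2 ^ c → a < c
2^-cancel-< a c 2^a<2^c with a <? c
... | yes a<c = a<c
... | no  a≮c = ⊥-elim (<⇒≱ 2^a<2^c (^-monoʳ-≤ 2 (≮⇒≥ a≮c)))

Pow2⇒pos : ∀ {x} → Pow2 x → 0 < x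
Pow2⇒pos (k , refl) = m^n>0 2 k

Pow2-< : ∀ {x y} → Pow2 x → Pow2 y → x < y → 2 * x ≤ y
Pow2-< (a , refl) (c , refl) x<y = ^-monoʳ-≤ 2 (2^-cancel-< a c x<y)

T-isPow2⁻ : ∀ {x} → T (isPow2 x) → Pow2 x
T-isPow2⁻ {x} t with T-any-upTo⁻ (λ k → 2 ^ k ≡ᵇ x) (suc x) t
... | k , _ , 2^k≡x = k , ≡ᵇ⇒≡ (2 ^ k) x 2^k≡x

T-isPow2⁺ : ∀ {x} → Pow2 x → T (isPow2 x)
T-isPow2⁺ (k , refl) = T-any-upTo⁺ (λ j → 2 ^ j ≡ᵇ 2 ^ k) (s≤s (<⇒≤ (n<2^n k))) (≡⇒≡ᵇ (2 ^ k) (2 ^ k) refl)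

Descending : ℕ → List ℕ → Set
Descending m []       = ⊤
Descending m (x ∷ xs) = x ≤ m × Descending x xs

Descending-weaken : ∀ {m m′} z → m ≤ m′ → Descending m z → Descending m′ z
Descending-weaken []      _    _            = tt
Descending-weaken (x ∷ z) m≤m′ (x≤m , desc) = ≤-trans x≤m m≤m′ , desc

Descending-∈ : ∀ {m x} z → Descending m z → x ∈ z → x ≤ m
Descending-∈ (y ∷ z) (y≤m , desc) (here refl) = y≤m
Descending-∈ (y ∷ z) (y≤m , desc) (there x∈z) = ≤-trans (Descending-∈ z desc x∈z) y≤m

Descending-sum : ∀ {m} z → Descending m z → Descending (sum z) z
Descending-sum []      _          = tt
Descending-sum (y ∷ z) (_ , desc) = m≤m+n y (sum z) , desc

partsLE-sound : ∀ f n m {z} → z ∈ partsLE f n m → Descending m z × All (0 <_) z × sum z ≡ n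
partsLE-sound zero    zero    m (here refl) = tt , [] , refl
partsLE-sound (suc f) zero    m (here refl) = tt , [] , refl
partsLE-sound (suc f) (suc n) m z∈
  with find (∈-concatMap⁻ (λ k → map (k ∷_) (partsLE f (suc n ∸ k) k)) {xs = applyUpTo suc (suc n ⊓ m)} z∈)
... | k , k∈ , z∈k with ∈-map⁻ (k ∷_) z∈k | ∈-applyUpTo⁻ suc k∈
...   | rest , rest∈ , refl | i , i<j , refl with partsLE-sound f (suc n ∸ suc i) (suc i) rest∈
...     | desc , pos , sum≡ =
  (≤-trans i<j (m⊓n≤n (suc n) m) , desc) , z<s ∷ pos ,
  trans (cong (suc i +_) sum≡) (m+[n∸m]≡n (≤-trans i<j (m⊓n≤m (suc n) m)))

sum≡0⇒[] : ∀ {z} → All (0 <_) z → sum z ≡ 0 → z ≡ []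
sum≡0⇒[] []            _      = refl
sum≡0⇒[] {x ∷ z} (0<x ∷ _) sum≡0 = ⊥-elim (<⇒≢ (≤-trans 0<x (m≤m+n x (sum z))) (sym sum≡0))

partsLE-complete : ∀ f n m {z} → n ≤ f → Descending m z → All (0 <_) z → sum z ≡ n → z ∈ partsLE f n m
partsLE-complete zero    zero    m _ _ pos sum≡ rewrite sum≡0⇒[] pos sum≡ = here refl
partsLE-complete (suc f) zero    m _ _ pos sum≡ rewrite sum≡0⇒[] pos sum≡ = here refl
partsLE-complete (suc f) (suc n) m {[]} _ _ _ ()
partsLE-complete (suc f) (suc n) m {suc i ∷ rest} (s≤s n≤f) (1+i≤m , desc) (_ ∷ pos) sum≡ =
  ∈-concatMap⁺ (λ k → map (k ∷_) (partsLE f (suc n ∸ k) k)) {xs = applyUpTo suc (suc n ⊓ m)}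
    (lose (∈-applyUpTo⁺ suc (⊓-glb 1+i≤1+n 1+i≤m)) (∈-map⁺ (suc i ∷_) rest∈))
  where
  1+i≤1+n : suc i ≤ suc n
  1+i≤1+n = subst (suc i ≤_) sum≡ (m≤m+n (suc i) (sum rest))
  rest∈ : rest ∈ partsLE f (suc n ∸ suc i) (suc i)
  rest∈ = partsLE-complete f (suc n ∸ suc i) (suc i) (≤-trans (m∸n≤m n i) n≤f) desc pos
            (sym (trans (cong (_∸ suc i) (sym sum≡)) (m+n∸m≡n (suc i) (sum rest))))

Unique-concatMap-∷ : ∀ ks (L : ℕ → List (List ℕ)) → Unique ks → (∀ k → Unique (L k)) →
                     Unique (concatMap (λ k → map (k ∷_) (L k)) ks)
Unique-concatMap-∷ []       L _             _        = []
Unique-concatMap-∷ (k ∷ ks) L (k∉ks ∷ uks) unique-L =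
  Unique.++⁺ (Unique.map⁺ ∷-injectiveʳ (unique-L k)) (Unique-concatMap-∷ ks L uks unique-L) disjoint
  where
  disjoint : ∀ {z} → z ∈ map (k ∷_) (L k) × z ∈ concatMap (λ k → map (k ∷_) (L k)) ks → ⊥
  disjoint (z∈k , z∈ks) with ∈-map⁻ (k ∷_) z∈k | find (∈-concatMap⁻ (λ k → map (k ∷_) (L k)) {xs = ks} z∈ks)
  ... | _ , _ , refl | k′ , k′∈ks , z∈k′ with ∈-map⁻ (k′ ∷_) z∈k′
  ...   | _ , _ , refl = All.lookup k∉ks k′∈ks refl

partsLE-unique : ∀ f n m → Unique (partsLE f n m)
partsLE-unique zero    zero    m = [] ∷ []
partsLE-unique zero    (suc n) m = []
partsLE-unique (suc f) zero    m = [] ∷ []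
partsLE-unique (suc f) (suc n) m =
  Unique-concatMap-∷ (applyUpTo suc (suc n ⊓ m)) (λ k → partsLE f (suc n ∸ k) k)
    (Unique.applyUpTo⁺₁ suc (suc n ⊓ m) (λ i<j _ → <⇒≢ i<j ∘ suc-injective))
    (λ k → partsLE-unique f (suc n ∸ k) k)

record BinaryPartition (n : ℕ) (z : List ℕ) : Set where
  field
    descending : Descending n z
    powers     : All Pow2 z
    sum≡       : sum z ≡ n

∈B⁻ : ∀ {n z} → z ∈ B n → BinaryPartition n z
∈B⁻ {n} {z} z∈B with ∈-filter⁻ (λ z → T? (all isPow2 z)) {xs = partsLE n n n} z∈B
... | z∈parts , all-pow2 with partsLE-sound n n n z∈parts
...   | desc , _ , sum≡ = record { descending = desc ; powers = All.map T-isPow2⁻ (all⁺ isPow2 z all-pow2) ; sum≡ = sum≡ }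

∈B⁺ : ∀ {n z} → BinaryPartition n z → z ∈ B n
∈B⁺ {n} {z} bp = ∈-filter⁺ (λ z → T? (all isPow2 z)) {xs = partsLE n n n}
  (partsLE-complete n n n ≤-refl descending (All.map Pow2⇒pos powers) sum≡) (all⁻ isPow2 (All.map T-isPow2⁺ powers))
  where open BinaryPartition bp

B-unique : ∀ n → Unique (B n)
B-unique n = Unique.filter⁺ (λ z → T? (all isPow2 z)) (partsLE-unique n n n)

-- Inserting a part

insertD-↭ : ∀ x xs → insertD x xs ↭ x ∷ xs
insertD-↭ x []       = ↭-refl
insertD-↭ x (y ∷ ys) with y ≤ᵇ x
... | true  = ↭-refl
... | false = ↭-trans (prep y (insertD-↭ x ys)) (swap y x ↭-refl)

sortD-↭ : ∀ xs → sortD xs ↭ xs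
sortD-↭ []       = ↭-refl
sortD-↭ (x ∷ xs) = ↭-trans (insertD-↭ x (sortD xs)) (prep x (sortD-↭ xs))

insertD-Descending : ∀ {m} i μ → i ≤ m → Descending m μ → Descending m (insertD i μ)
insertD-Descending i []       i≤m _            = i≤m , tt
insertD-Descending i (y ∷ μ) i≤m (y≤m , desc) with y ≤ᵇ i in y≤ᵇi
... | true  = i≤m , ≤ᵇ⇒≤ y i (subst T (sym y≤ᵇi) _) , desc
... | false = y≤m , insertD-Descending i μ (≰⇒≥ (λ y≤i → subst T y≤ᵇi (≤⇒≤ᵇ y≤i))) desc

removeFirst : ℕ → List ℕ → List ℕ
removeFirst i []       = []
removeFirst i (y ∷ ys) with y ≟ i
... | yes _ = ys
... | no  _ = y ∷ removeFirst i ys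

removeFirst-insertD : ∀ i μ → removeFirst i (insertD i μ) ≡ μ
removeFirst-insertD i [] with i ≟ i
... | yes _   = refl
... | no  i≢i = ⊥-elim (i≢i refl)
removeFirst-insertD i (y ∷ μ) with y ≤ᵇ i in y≤ᵇi
... | true with i ≟ i
...   | yes _   = refl
...   | no  i≢i = ⊥-elim (i≢i refl)
removeFirst-insertD i (y ∷ μ) | false with y ≟ i
...   | yes refl = ⊥-elim (subst T y≤ᵇi (≤⇒≤ᵇ (≤-refl {y})))
...   | no  _    = cong (y ∷_) (removeFirst-insertD i μ)

insertD-injective : ∀ i {μ ν} → insertD i μ ≡ insertD i ν → μ ≡ ν
insertD-injective i {μ} {ν} eq = begin
  μ                            ≡⟨ removeFirst-insertD i μ ⟨
  removeFirst i (insertD i μ)  ≡⟨ cong (removeFirst i) eq ⟩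
  removeFirst i (insertD i ν)  ≡⟨ removeFirst-insertD i ν ⟩
  ν                            ∎

insertD-removeFirst : ∀ {m} i z → Descending m z → i ∈ z → insertD i (removeFirst i z) ≡ z
insertD-removeFirst i (y ∷ z) (y≤m , desc) i∈ with y ≟ i
insertD-removeFirst i (y ∷ [])      _                  i∈ | yes refl = refl
insertD-removeFirst i (y ∷ y′ ∷ z) (_ , y′≤y , _)     i∈ | yes refl with y′ ≤ᵇ y in y′≤ᵇy
... | true  = refl
... | false = ⊥-elim (subst T y′≤ᵇy (≤⇒≤ᵇ y′≤y))
insertD-removeFirst i (y ∷ z) (y≤m , desc) (here refl)  | no y≢i = ⊥-elim (y≢i refl)
insertD-removeFirst i (y ∷ z) (y≤m , desc) (there i∈z) | no y≢i with y ≤ᵇ i in y≤ᵇi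
... | true  = ⊥-elim (y≢i (≤-antisym (≤ᵇ⇒≤ y i (subst T (sym y≤ᵇi) _)) (Descending-∈ z desc i∈z)))
... | false = cong (y ∷_) (insertD-removeFirst i z desc i∈z)

removeFirst-Descending : ∀ {m} i z → Descending m z → Descending m (removeFirst i z)
removeFirst-Descending i []      _            = tt
removeFirst-Descending i (y ∷ z) (y≤m , desc) with y ≟ i
... | yes _ = Descending-weaken z y≤m desc
... | no  _ = y≤m , removeFirst-Descending i z desc

removeFirst-All : ∀ {P : ℕ → Set} i {z} → All P z → All P (removeFirst i z)
removeFirst-All i []                = []
removeFirst-All i {y ∷ z} (py ∷ pz) with y ≟ i
... | yes _ = pz
... | no  _ = py ∷ removeFirst-All i pz

sum-removeFirst : ∀ i {z} → i ∈ z → i + sum (removeFirst i z) ≡ sum z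
sum-removeFirst i {y ∷ z} i∈ with y ≟ i | i∈
... | yes refl | _          = refl
... | no  y≢i  | here refl  = ⊥-elim (y≢i refl)
... | no  y≢i  | there i∈z = trans (+-exchange i y _) (cong (y +_) (sum-removeFirst i i∈z))

insertD-BinaryPartition : ∀ {i n μ} → Pow2 i → BinaryPartition n μ → BinaryPartition (i + n) (insertD i μ)
insertD-BinaryPartition {i} {n} {μ} pow2 bp = record
  { descending = insertD-Descending i μ (m≤m+n i n) (Descending-weaken μ (m≤n+m n i) descending)
  ; powers     = ↭.All-resp-↭ (↭-sym (insertD-↭ i μ)) (pow2 ∷ powers)
  ; sum≡       = trans (sum-↭ (insertD-↭ i μ)) (cong (i +_) sum≡)
  }
  where open BinaryPartition bp

removeFirst-BinaryPartition : ∀ {i n z} → i ∈ z → BinaryPartition (i + n) z → BinaryPartition n (removeFirst i z)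
removeFirst-BinaryPartition {i} {n} {z} i∈z bp = record
  { descending = subst (λ m → Descending m (removeFirst i z)) sum≡n
                   (Descending-sum (removeFirst i z) (removeFirst-Descending i z descending))
  ; powers     = removeFirst-All i powers
  ; sum≡       = sum≡n
  }
  where
  open BinaryPartition bp
  sum≡n : sum (removeFirst i z) ≡ n
  sum≡n = +-cancelˡ-≡ i _ _ (trans (sum-removeFirst i i∈z) sum≡)

b : ℕ → ℕ
b n = length (B n)

∑B : ℕ → (List ℕ → ℕ) → ℕ
∑B n F = sum (map F (B n))

∑B-const-1 : ∀ n → ∑B n (λ _ → 1) ≡ b n
∑B-const-1 n = sum-map-const-1 (B n)

B∋ B∌ : ℕ → ℕ → List (List ℕ)
B∋ i m = filter (i ∈?_) (B m)
B∌ i m = filter (¬? ∘ (i ∈?_)) (B m)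

sum-map-B∋ : ∀ {i} n F → Pow2 i → sum (map F (B∋ i (i + n))) ≡ ∑B n (F ∘ insertD i)
sum-map-B∋ {i} n F pow2 = begin
  sum (map F (B∋ i (i + n)))             ≡⟨ sum-map-unique-∈⇔ F unique-B∋ unique-insertD B∋⊆ ⊆B∋ ⟩
  sum (map F (map (insertD i) (B n)))    ≡⟨ cong sum (map-∘ (B n)) ⟨
  ∑B n (F ∘ insertD i)                   ∎
  where
  unique-B∋ : Unique (B∋ i (i + n))
  unique-B∋ = Unique.filter⁺ (i ∈?_) (B-unique (i + n))
  unique-insertD : Unique (map (insertD i) (B n))
  unique-insertD = Unique.map⁺ (insertD-injective i) (B-unique n)
  B∋⊆ : ∀ {z} → z ∈ B∋ i (i + n) → z ∈ map (insertD i) (B n)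
  B∋⊆ {z} z∈ with ∈-filter⁻ (i ∈?_) {xs = B (i + n)} z∈
  ... | z∈B , i∈z = subst (_∈ map (insertD i) (B n)) (insertD-removeFirst i z (BinaryPartition.descending bp) i∈z)
                      (∈-map⁺ (insertD i) (∈B⁺ (removeFirst-BinaryPartition i∈z bp)))
    where bp = ∈B⁻ z∈B
  ⊆B∋ : ∀ {z} → z ∈ map (insertD i) (B n) → z ∈ B∋ i (i + n)
  ⊆B∋ z∈ with ∈-map⁻ (insertD i) z∈
  ... | μ , μ∈B , refl = ∈-filter⁺ (i ∈?_) {xs = B (i + n)}
                           (∈B⁺ (insertD-BinaryPartition pow2 (∈B⁻ μ∈B)))
                           (↭.Any-resp-↭ (↭-sym (insertD-↭ i μ)) (here refl))

∑B-insertD : ∀ {i} n F → Pow2 i → ∑B (i + n) F ≡ ∑B n (F ∘ insertD i) + sum (map F (B∌ i (i + n)))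
∑B-insertD {i} n F pow2 =
  trans (sum-map-filter (i ∈?_) F (B (i + n))) (cong (_+ sum (map F (B∌ i (i + n)))) (sum-map-B∋ n F pow2))

∑B-insertD-vanishing : ∀ {i} n F → Pow2 i → (∀ {z} → i ∉ z → F z ≡ 0) → ∑B (i + n) F ≡ ∑B n (F ∘ insertD i)
∑B-insertD-vanishing {i} n F pow2 F≡0 =
  trans (sum-map-filter-vanishing (i ∈?_) F (B (i + n)) (λ _ → F≡0)) (sum-map-B∋ n F pow2)

∑B-vanishing : ∀ {i n} F → n < i → (∀ {z} → i ∉ z → F z ≡ 0) → ∑B n F ≡ 0
∑B-vanishing {i} {n} F n<i F≡0 = sum-map-zero (B n) (λ z∈B → F≡0 (λ i∈z →
  <⇒≱ n<i (Descending-∈ _ (BinaryPartition.descending (∈B⁻ z∈B)) i∈z)))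

-- Multiplicities

mult-↭ : ∀ i {xs ys} → xs ↭ ys → mult i xs ≡ mult i ys
mult-↭ i xs↭ys = ↭.↭-length (↭.filter-↭ (_≟ i) xs↭ys)

mult-∷-≡ : ∀ {i x} xs → x ≡ i → mult i (x ∷ xs) ≡ suc (mult i xs)
mult-∷-≡ {i} {x} xs x≡i = cong length (filter-accept (_≟ i) {x} {xs} x≡i)

mult-∷-≢ : ∀ {i x} xs → x ≢ i → mult i (x ∷ xs) ≡ mult i xs
mult-∷-≢ {i} {x} xs x≢i = cong length (filter-reject (_≟ i) {x} {xs} x≢i)

mult-++ : ∀ i xs ys → mult i (xs ++ ys) ≡ mult i xs + mult i ys
mult-++ i xs ys = trans (cong length (filter-++ (_≟ i) xs ys)) (length-++ (filter (_≟ i) xs))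

mult-∉ : ∀ {i} z → i ∉ z → mult i z ≡ 0
mult-∉ []      _   = refl
mult-∉ (y ∷ z) i∉ = trans (mult-∷-≢ {x = y} z (λ { refl → i∉ (here refl) })) (mult-∉ z (i∉ ∘ there))

mult-insertD-≡ : ∀ i μ → mult i (insertD i μ) ≡ suc (mult i μ)
mult-insertD-≡ i μ = trans (mult-↭ i (insertD-↭ i μ)) (mult-∷-≡ μ refl)

mult-insertD-≢ : ∀ {i j} μ → i ≢ j → mult j (insertD i μ) ≡ mult j μ
mult-insertD-≢ {i} {j} μ i≢j = trans (mult-↭ j (insertD-↭ i μ)) (mult-∷-≢ μ i≢j)

multSet-B-+ : ∀ {i} n → Pow2 i → multSet i (B (i + n)) ≡ multSet i (B n) + b n
multSet-B-+ {i} n pow2 = begin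
  ∑B (i + n) (mult i)                        ≡⟨ ∑B-insertD-vanishing n (mult i) pow2 (mult-∉ _) ⟩
  ∑B n (mult i ∘ insertD i)                  ≡⟨ sum-map-cong (B n) (λ {μ} _ → trans (mult-insertD-≡ i μ) (+-comm 1 (mult i μ))) ⟩
  ∑B n (λ μ → mult i μ + 1)                  ≡⟨ sum-map-+ (mult i) (λ _ → 1) (B n) ⟩
  multSet i (B n) + ∑B n (λ _ → 1)           ≡⟨ cong (multSet i (B n) +_) (∑B-const-1 n) ⟩
  multSet i (B n) + b n                      ∎

multSet-B-< : ∀ {i n} → n < i → multSet i (B n) ≡ 0
multSet-B-< n<i = ∑B-vanishing (mult _) n<i (mult-∉ _)

∑m₁m₄ ∑m₂C2 : ℕ → ℕ
∑m₁m₄ n = ∑B n (λ z → mult 1 z * mult 4 z)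
∑m₂C2 n = ∑B n (λ z → mult 2 z C 2)

∑m₁m₄-+4 : ∀ n → ∑m₁m₄ (4 + n) ≡ ∑m₁m₄ n + multSet 1 (B n)
∑m₁m₄-+4 n = begin
  ∑B (4 + n) F                                     ≡⟨ ∑B-insertD-vanishing n F (2 , refl) F≡0 ⟩
  ∑B n (F ∘ insertD 4)                             ≡⟨ sum-map-cong (B n) (λ {μ} _ → step μ) ⟩
  ∑B n (λ μ → F μ + mult 1 μ)                      ≡⟨ sum-map-+ F (mult 1) (B n) ⟩
  ∑m₁m₄ n + multSet 1 (B n)                        ∎
  where
  F : List ℕ → ℕ
  F z = mult 1 z * mult 4 z
  F≡0 : ∀ {z} → 4 ∉ z → F z ≡ 0
  F≡0 {z} 4∉z = trans (cong (mult 1 z *_) (mult-∉ z 4∉z)) (*-zeroʳ (mult 1 z))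
  step : ∀ μ → F (insertD 4 μ) ≡ F μ + mult 1 μ
  step μ = begin
    mult 1 (insertD 4 μ) * mult 4 (insertD 4 μ)  ≡⟨ cong₂ _*_ (mult-insertD-≢ μ (λ ())) (mult-insertD-≡ 4 μ) ⟩
    mult 1 μ * suc (mult 4 μ)                    ≡⟨ *-suc (mult 1 μ) (mult 4 μ) ⟩
    mult 1 μ + F μ                               ≡⟨ +-comm (mult 1 μ) (F μ) ⟩
    F μ + mult 1 μ                               ∎

suc-C2 : ∀ m → suc m C 2 ≡ m C 2 + m
suc-C2 m = begin
  suc m C 2          ≡⟨ nCk+nC[k+1]≡[n+1]C[k+1] m 1 ⟨
  m C 1 + m C 2      ≡⟨ cong (_+ m C 2) (nC1≡n m) ⟩
  m + m C 2          ≡⟨ +-comm m (m C 2) ⟩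
  m C 2 + m          ∎

∑m₂C2-+2 : ∀ n → ∑m₂C2 (2 + n) ≡ ∑m₂C2 n + multSet 2 (B n)
∑m₂C2-+2 n = begin
  ∑B (2 + n) F                          ≡⟨ ∑B-insertD-vanishing n F (1 , refl) (λ {z} 2∉z → cong (_C 2) (mult-∉ z 2∉z)) ⟩
  ∑B n (F ∘ insertD 2)                  ≡⟨ sum-map-cong (B n) (λ {μ} _ → trans (cong (_C 2) (mult-insertD-≡ 2 μ)) (suc-C2 (mult 2 μ))) ⟩
  ∑B n (λ μ → F μ + mult 2 μ)           ≡⟨ sum-map-+ F (mult 2) (B n) ⟩
  ∑m₂C2 n + multSet 2 (B n)             ∎
  where
  F : List ℕ → ℕ
  F z = mult 2 z C 2

-- Injectivity of pre₂

powerSum : ℕ → List ℕ → ℕ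
powerSum k z = sum (map (_^ k) z)

powerSum-1 : ∀ z → powerSum 1 z ≡ sum z
powerSum-1 []      = refl
powerSum-1 (x ∷ z) = cong₂ _+_ (*-identityʳ x) (powerSum-1 z)

powerSum-++ : ∀ k xs ys → powerSum k (xs ++ ys) ≡ powerSum k xs + powerSum k ys
powerSum-++ k xs ys = trans (cong sum (map-++ (_^ k) xs ys)) (sum-++ (map (_^ k) xs) (map (_^ k) ys))

powerSum-map-* : ∀ k x xs → powerSum k (map (x *_) xs) ≡ x ^ k * powerSum k xs
powerSum-map-* k x []       = sym (*-zeroʳ (x ^ k))
powerSum-map-* k x (y ∷ ys) = begin
  (x * y) ^ k + powerSum k (map (x *_) ys)  ≡⟨ cong₂ _+_ (*-distrib-^ x y k) (powerSum-map-* k x ys) ⟩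
  x ^ k * y ^ k + x ^ k * powerSum k ys     ≡⟨ *-distribˡ-+ (x ^ k) (y ^ k) (powerSum k ys) ⟨
  x ^ k * powerSum k (y ∷ ys)               ∎

powerSum-pre₂ : ∀ k z → powerSum k (pre₂ z) ≡ powerSum k (pairProducts z)
powerSum-pre₂ k z = sum-↭ (↭.map⁺ (_^ k) (sortD-↭ (pairProducts z)))

powerSum-square : ∀ k z → powerSum k z * powerSum k z ≡ powerSum (k + k) z + 2 * powerSum k (pairProducts z)
powerSum-square k []      = refl
powerSum-square k (x ∷ z) = begin
  (a + P) * (a + P)                 ≡⟨ square-+ a P ⟩
  a * a + P * P + 2 * (a * P)       ≡⟨ cong (λ s → a * a + s + 2 * (a * P)) (powerSum-square k z) ⟩
  a * a + (Q + 2 * R) + 2 * (a * P) ≡⟨ regroup (a * a) Q R (a * P) ⟩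
  a * a + Q + 2 * (a * P + R)       ≡⟨ cong₂ (λ s t → s + Q + 2 * t) (^-distribˡ-+-* x k k) pairs ⟨
  x ^ (k + k) + Q + 2 * powerSum k (pairProducts (x ∷ z)) ∎
  where
  a = x ^ k
  P = powerSum k z
  Q = powerSum (k + k) z
  R = powerSum k (pairProducts z)
  square-+ : ∀ a P → (a + P) * (a + P) ≡ a * a + P * P + 2 * (a * P)
  square-+ = solve-∀
  regroup : ∀ aa Q R aP → aa + (Q + 2 * R) + 2 * aP ≡ aa + Q + 2 * (aP + R)
  regroup = solve-∀
  pairs : powerSum k (pairProducts (x ∷ z)) ≡ a * P + R
  pairs = trans (powerSum-++ k (map (x *_) z) (pairProducts z)) (cong (_+ R) (powerSum-map-* k x z))

powerSum-2^-pre₂ : ∀ z z′ → sum z ≡ sum z′ → pre₂ z ≡ pre₂ z′ → ∀ j → powerSum (2 ^ j) z ≡ powerSum (2 ^ j) z′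
powerSum-2^-pre₂ z z′ sum≡ pre₂≡ zero = trans (powerSum-1 z) (trans sum≡ (sym (powerSum-1 z′)))
powerSum-2^-pre₂ z z′ sum≡ pre₂≡ (suc j) =
  subst (λ m → powerSum m z ≡ powerSum m z′) (cong (2 ^ j +_) (sym (+-identityʳ (2 ^ j)))) $
  +-cancelʳ-≡ (2 * R z) _ _ $ begin
    powerSum (k + k) z + 2 * R z    ≡⟨ powerSum-square k z ⟨
    powerSum k z * powerSum k z     ≡⟨ cong₂ _*_ ih ih ⟩
    powerSum k z′ * powerSum k z′   ≡⟨ powerSum-square k z′ ⟩
    powerSum (k + k) z′ + 2 * R z′  ≡⟨ cong (λ r → powerSum (k + k) z′ + 2 * r) R≡ ⟨
    powerSum (k + k) z′ + 2 * R z   ∎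
  where
  k = 2 ^ j
  R : List ℕ → ℕ
  R w = powerSum k (pairProducts w)
  ih : powerSum k z ≡ powerSum k z′
  ih = powerSum-2^-pre₂ z z′ sum≡ pre₂≡ j
  R≡ : R z ≡ R z′
  R≡ = trans (sym (powerSum-pre₂ k z)) (trans (cong (powerSum k) pre₂≡) (powerSum-pre₂ k z′))

powerSum-≤ : ∀ N {m} z → Descending m z → powerSum N z ≤ length z * m ^ N
powerSum-≤ N []      _            = z≤n
powerSum-≤ N (y ∷ z) (y≤m , desc) =
  +-mono-≤ (^-monoˡ-≤ N y≤m) (≤-trans (powerSum-≤ N z desc) (*-monoʳ-≤ (length z) (^-monoˡ-≤ N y≤m)))

-- y ≥ 2x, so yᴺ ≥ 2ᴺxᴺ exceeds the fewer than 2ᴺ terms of the left sum, each at most xᴺ.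
powerSum-dominated : ∀ N {x y} xs ys → Descending x xs → All Pow2 (x ∷ xs) → Pow2 y →
                     length (x ∷ xs) < 2 ^ N → x < y → powerSum N (x ∷ xs) < powerSum N (y ∷ ys)
powerSum-dominated N {x} {y} xs ys desc (pow2-x ∷ _) pow2-y short x<y =
  ≤-<-trans (powerSum-≤ N (x ∷ xs) (≤-refl , desc)) $
  <-≤-trans (*-monoˡ-< (x ^ N) {{m^n≢0 x N {{>-nonZero (Pow2⇒pos pow2-x)}}}} short) $
  ≤-trans (≤-reflexive (sym (*-distrib-^ 2 x N))) $
  ≤-trans (^-monoˡ-≤ N (Pow2-< pow2-x pow2-y x<y)) $
  m≤m+n (y ^ N) (powerSum N ys)

powerSum-injective : ∀ N {m m′} z z′ → Descending m z → Descending m′ z′ → All Pow2 z → All Pow2 z′ →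
                     length z < 2 ^ N → length z′ < 2 ^ N → powerSum N z ≡ powerSum N z′ → z ≡ z′
powerSum-injective N []       []       _ _ _ _ _ _ _ = refl
powerSum-injective N []       (y ∷ z′) _ _ _ (pow2-y ∷ _) _ _ eq =
  ⊥-elim (<⇒≢ (≤-trans (m^n>0 y {{>-nonZero (Pow2⇒pos pow2-y)}} N) (m≤m+n (y ^ N) _)) eq)
powerSum-injective N (x ∷ z) []        _ _ (pow2-x ∷ _) _ _ _ eq =
  ⊥-elim (<⇒≢ (≤-trans (m^n>0 x {{>-nonZero (Pow2⇒pos pow2-x)}} N) (m≤m+n (x ^ N) _)) (sym eq))
powerSum-injective N (x ∷ z) (y ∷ z′) (_ , desc) (_ , desc′) (px ∷ pz) (py ∷ pz′) short short′ eq
  with <-cmp x y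
... | tri< x<y _ _ = ⊥-elim (<⇒≢ (powerSum-dominated N z z′ desc (px ∷ pz) py short x<y) eq)
... | tri> _ _ y<x = ⊥-elim (<⇒≢ (powerSum-dominated N z′ z desc′ (py ∷ pz′) px short′ y<x) (sym eq))
... | tri≈ _ refl _ = cong (x ∷_) (powerSum-injective N z z′ desc desc′ pz pz′
                        (<-trans (n<1+n _) short) (<-trans (n<1+n _) short′) (+-cancelˡ-≡ (x ^ N) _ _ eq))

length≤sum : ∀ {z} → All Pow2 z → length z ≤ sum z
length≤sum []             = z≤n
length≤sum (pow2 ∷ pows) = +-mono-≤ (Pow2⇒pos pow2) (length≤sum pows)

-- N = 2ⁿ is a power of 2, and 2ᴺ exceeds the number of parts, which is at most n.
pre₂-injective : ∀ {n z z′} → BinaryPartition n z → BinaryPartition n z′ → pre₂ z ≡ pre₂ z′ → z ≡ z′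
pre₂-injective {n} {z} {z′} bp bp′ pre₂≡ =
  powerSum-injective N z z′ (descending bp) (descending bp′) (powers bp) (powers bp′) (short bp) (short bp′)
    (powerSum-2^-pre₂ z z′ (trans (sum≡ bp) (sym (sum≡ bp′))) pre₂≡ n)
  where
  open BinaryPartition
  N = 2 ^ n
  short : ∀ {w} → BinaryPartition n w → length w < 2 ^ N
  short bpw = ≤-<-trans (≤-trans (length≤sum (powers bpw)) (≤-reflexive (sum≡ bpw)))
                        (<-trans (n<2^n n) (n<2^n N))

mult-map : ∀ {f : ℕ → ℕ} {j k} xs → (∀ {y} → f y ≡ j → y ≡ k) → f k ≡ j → mult j (map f xs) ≡ mult k xs
mult-map []       _     _     = refl
mult-map {f} {j} {k} (y ∷ xs) f⁻¹ fk≡j with y ≟ k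
... | yes refl = begin
  mult j (f y ∷ map f xs)  ≡⟨ mult-∷-≡ (map f xs) fk≡j ⟩
  suc (mult j (map f xs))  ≡⟨ cong suc (mult-map xs f⁻¹ fk≡j) ⟩
  suc (mult k xs)          ≡⟨ mult-∷-≡ xs refl ⟨
  mult k (y ∷ xs)          ∎
... | no  y≢k  = begin
  mult j (f y ∷ map f xs)  ≡⟨ mult-∷-≢ (map f xs) (y≢k ∘ f⁻¹) ⟩
  mult j (map f xs)        ≡⟨ mult-map xs f⁻¹ fk≡j ⟩
  mult k xs                ≡⟨ mult-∷-≢ xs y≢k ⟨
  mult k (y ∷ xs)          ∎

mult-map-∉ : ∀ {f : ℕ → ℕ} {j} xs → (∀ y → f y ≢ j) → mult j (map f xs) ≡ 0
mult-map-∉ {f} xs f≢j = mult-∉ (map f xs) (λ j∈ → let y , _ , j≡fy = ∈-map⁻ f j∈ in f≢j y (sym j≡fy))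

mult4-pairProducts : ∀ {z} → All Pow2 z → mult 4 (pairProducts z) ≡ mult 1 z * mult 4 z + mult 2 z C 2
mult4-pairProducts []                      = refl
mult4-pairProducts {_ ∷ xs} ((a , refl) ∷ pows) = begin
  mult 4 (map (2 ^ a *_) xs ++ pairProducts xs)            ≡⟨ mult-++ 4 (map (2 ^ a *_) xs) (pairProducts xs) ⟩
  mult 4 (map (2 ^ a *_) xs) + mult 4 (pairProducts xs)    ≡⟨ cong (mult 4 (map (2 ^ a *_) xs) +_) (mult4-pairProducts pows) ⟩
  mult 4 (map (2 ^ a *_) xs) + (m₁ * m₄ + m₂ C 2)          ≡⟨ new-pairs a ⟩
  mult 1 (2 ^ a ∷ xs) * mult 4 (2 ^ a ∷ xs) + mult 2 (2 ^ a ∷ xs) C 2 ∎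
  where
  m₁ = mult 1 xs
  m₂ = mult 2 xs
  m₄ = mult 4 xs
  new-pairs : ∀ a → mult 4 (map (2 ^ a *_) xs) + (m₁ * m₄ + m₂ C 2)
                  ≡ mult 1 (2 ^ a ∷ xs) * mult 4 (2 ^ a ∷ xs) + mult 2 (2 ^ a ∷ xs) C 2
  new-pairs zero = begin
    mult 4 (map (1 *_) xs) + (m₁ * m₄ + m₂ C 2)  ≡⟨ cong (_+ (m₁ * m₄ + m₂ C 2)) (mult-map xs (trans (sym (*-identityˡ _))) refl) ⟩
    m₄ + (m₁ * m₄ + m₂ C 2)                       ≡⟨ +-assoc m₄ (m₁ * m₄) (m₂ C 2) ⟨
    suc m₁ * m₄ + m₂ C 2                          ∎
  new-pairs (suc zero) = begin
    mult 4 (map (2 *_) xs) + (m₁ * m₄ + m₂ C 2)  ≡⟨ cong (_+ (m₁ * m₄ + m₂ C 2)) (mult-map xs (*-cancelˡ-≡ _ 2 2) refl) ⟩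
    m₂ + (m₁ * m₄ + m₂ C 2)                       ≡⟨ +-rotate m₂ (m₁ * m₄) (m₂ C 2) ⟩
    m₁ * m₄ + (m₂ C 2 + m₂)                       ≡⟨ cong (m₁ * m₄ +_) (suc-C2 m₂) ⟨
    m₁ * m₄ + suc m₂ C 2                          ∎
  new-pairs (suc (suc zero)) = begin
    mult 4 (map (4 *_) xs) + (m₁ * m₄ + m₂ C 2)  ≡⟨ cong (_+ (m₁ * m₄ + m₂ C 2)) (mult-map xs (*-cancelˡ-≡ _ 1 4) refl) ⟩
    m₁ + (m₁ * m₄ + m₂ C 2)                       ≡⟨ +-assoc m₁ (m₁ * m₄) (m₂ C 2) ⟨
    m₁ + m₁ * m₄ + m₂ C 2                         ≡⟨ cong (_+ m₂ C 2) (*-suc m₁ m₄) ⟨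
    m₁ * suc m₄ + m₂ C 2                          ∎
  new-pairs a@(suc (suc (suc _))) = begin
    mult 4 (map (x *_) xs) + (m₁ * m₄ + m₂ C 2)  ≡⟨ cong (_+ (m₁ * m₄ + m₂ C 2)) (mult-map-∉ xs x*y≢4) ⟩
    m₁ * m₄ + m₂ C 2                              ≡⟨ cong₂ (λ p q → p * q + m₂ C 2) (mult-∷-≢ xs (x≢ (≤ᵇ⇒≤ 2 8 _))) (mult-∷-≢ xs (x≢ (≤ᵇ⇒≤ 5 8 _))) ⟨
    mult 1 (x ∷ xs) * mult 4 (x ∷ xs) + m₂ C 2    ≡⟨ cong (λ m → mult 1 (x ∷ xs) * mult 4 (x ∷ xs) + m C 2) (mult-∷-≢ xs (x≢ (≤ᵇ⇒≤ 3 8 _))) ⟨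
    mult 1 (x ∷ xs) * mult 4 (x ∷ xs) + mult 2 (x ∷ xs) C 2 ∎
    where
    x = 2 ^ a
    8≤x : 8 ≤ x
    8≤x = ^-monoʳ-≤ 2 {3} {a} (s≤s (s≤s (s≤s z≤n)))
    x≢ : ∀ {j} → j < 8 → x ≢ j
    x≢ j<8 x≡j = <⇒≱ j<8 (subst (8 ≤_) x≡j 8≤x)
    x*y≢4 : ∀ y → x * y ≢ 4
    x*y≢4 zero    x*0≡4 = 0≢1+n (trans (sym (*-zeroʳ x)) x*0≡4)
    x*y≢4 (suc y) x*y≡4 = <⇒≱ (≤ᵇ⇒≤ 5 8 _) (subst (8 ≤_) x*y≡4 (≤-trans 8≤x (m≤m*n x (suc y))))

B₂⊆B : ∀ {n z} → z ∈ B₂ n → z ∈ B n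
B₂⊆B {n} z∈ = proj₁ (∈-filter⁻ (λ z → T? (2 ≤ᵇ length z)) {xs = B n} z∈)

c≡∑B-pre₂ : ∀ n → c n ≡ ∑B n (mult 4 ∘ pre₂)
c≡∑B-pre₂ n = begin
  sum (map (mult 4) (deduplicate (≡-dec _≟_) (map pre₂ (B₂ n))))   ≡⟨ sum-map-deduplicate (≡-dec _≟_) (mult 4) unique-images ⟩
  sum (map (mult 4) (map pre₂ (B₂ n)))                               ≡⟨ cong sum (map-∘ (B₂ n)) ⟨
  sum (map (mult 4 ∘ pre₂) (B₂ n))                                   ≡⟨ sum-map-filter-vanishing at-least-2 (mult 4 ∘ pre₂) (B n) short ⟨
  ∑B n (mult 4 ∘ pre₂)                                               ∎
  where
  at-least-2 : ∀ z → Dec (T (2 ≤ᵇ length z))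
  at-least-2 z = T? (2 ≤ᵇ length z)
  unique-images : Unique (map pre₂ (B₂ n))
  unique-images = Unique-map⁺ (λ x∈ y∈ → pre₂-injective (∈B⁻ {n} (B₂⊆B {n} x∈)) (∈B⁻ {n} (B₂⊆B {n} y∈)))
                              (Unique.filter⁺ at-least-2 (B-unique n))
  short : ∀ {z} → z ∈ B n → ¬ T (2 ≤ᵇ length z) → mult 4 (pre₂ z) ≡ 0
  short {[]}        _ _     = refl
  short {_ ∷ []}    _ _     = refl
  short {_ ∷ _ ∷ _} _ 2≰len = ⊥-elim (2≰len tt)

c≡∑m₁m₄+∑m₂C2 : ∀ n → c n ≡ ∑m₁m₄ n + ∑m₂C2 n
c≡∑m₁m₄+∑m₂C2 n = begin
  c n                                                     ≡⟨ c≡∑B-pre₂ n ⟩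
  ∑B n (mult 4 ∘ pre₂)                                    ≡⟨ sum-map-cong (B n) count ⟩
  ∑B n (λ z → mult 1 z * mult 4 z + mult 2 z C 2)         ≡⟨ sum-map-+ (λ z → mult 1 z * mult 4 z) (λ z → mult 2 z C 2) (B n) ⟩
  ∑m₁m₄ n + ∑m₂C2 n                                       ∎
  where
  count : ∀ {z} → z ∈ B n → mult 4 (pre₂ z) ≡ mult 1 z * mult 4 z + mult 2 z C 2
  count {z} z∈B = trans (mult-↭ 4 (sortD-↭ (pairProducts z))) (mult4-pairProducts (BinaryPartition.powers (∈B⁻ {n} z∈B)))

-- The product formula

allBelow : ℕ → List ℕ → ℕ
allBelow N z = δ (does (All.all? (_<? 2 ^ N) z))

allBelow-cong : ∀ N M {z w} → (All (_< 2 ^ N) z → All (_< 2 ^ M) w) → (All (_< 2 ^ M) w → All (_< 2 ^ N) z) →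
                allBelow N z ≡ allBelow M w
allBelow-cong N M {z} {w} to from = cong δ (does-⇔ (mk⇔ to from) (All.all? (_<? 2 ^ N) z) (All.all? (_<? 2 ^ M) w))

allBelow-no : ∀ N {z} → ¬ All (_< 2 ^ N) z → allBelow N z ≡ 0
allBelow-no N {z} ¬all = cong δ (dec-false (All.all? (_<? 2 ^ N) z) ¬all)

allBelow-yes : ∀ N {z} → All (_< 2 ^ N) z → allBelow N z ≡ 1
allBelow-yes N {z} all = cong δ (dec-true (All.all? (_<? 2 ^ N) z) all)

bBelow : ℕ → ℕ → ℕ
bBelow N n = ∑B n (allBelow N)

bBelow-zero : ∀ n → bBelow 0 n ≡ one n
bBelow-zero zero    = refl
bBelow-zero (suc n) = sum-map-zero (B (suc n)) (λ z∈B → allBelow-no 0 (nonempty (∈B⁻ {suc n} z∈B)))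
  where
  nonempty : ∀ {z} → BinaryPartition (suc n) z → ¬ All (_< 1) z
  nonempty {[]}    bp = λ _ → 0≢1+n (BinaryPartition.sum≡ bp)
  nonempty {_ ∷ _} bp (x<1 ∷ _) with BinaryPartition.powers bp
  ... | pow2 ∷ _ = <⇒≱ x<1 (Pow2⇒pos pow2)

bBelow-large : ∀ N {n} → n < 2 ^ N → bBelow N n ≡ b n
bBelow-large N {n} n<2^N = trans (sum-map-cong (B n) (λ z∈B → allBelow-yes N (all-small z∈B))) (∑B-const-1 n)
  where
  all-small : ∀ {z} → z ∈ B n → All (_< 2 ^ N) z
  all-small {z} z∈B = All.tabulate (λ x∈z → ≤-<-trans (Descending-∈ z (BinaryPartition.descending (∈B⁻ {n} z∈B)) x∈z) n<2^N)

2^N<2^[1+N] : ∀ N → 2 ^ N < 2 ^ suc N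
2^N<2^[1+N] N = ^-monoʳ-< 2 (s≤s (s≤s z≤n)) (n<1+n N)

-- A binary partition without the part 2ᴺ has all parts below 2ᴺ⁺¹ iff it has all parts below 2ᴺ.
bBelow-suc-+ : ∀ N n → bBelow (suc N) (2 ^ N + n) ≡ bBelow N (2 ^ N + n) + bBelow (suc N) n
bBelow-suc-+ N n = begin
  bBelow (suc N) (i + n)                                      ≡⟨ ∑B-insertD n (allBelow (suc N)) (N , refl) ⟩
  ∑B n (allBelow (suc N) ∘ insertD i) + sum (map (allBelow (suc N)) (B∌ i (i + n)))
                                                              ≡⟨ cong₂ _+_ (sum-map-cong (B n) (λ {μ} _ → insertD-below μ))
                                                                            (sum-map-cong (B∌ i (i + n)) without-i) ⟩
  bBelow (suc N) n + sum (map (allBelow N) (B∌ i (i + n)))   ≡⟨ +-comm (bBelow (suc N) n) _ ⟩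
  sum (map (allBelow N) (B∌ i (i + n))) + bBelow (suc N) n   ≡⟨ cong (_+ bBelow (suc N) n) (sum-map-filter-vanishing
                                                                   (¬? ∘ (i ∈?_)) (allBelow N) (B (i + n)) with-i) ⟨
  bBelow N (i + n) + bBelow (suc N) n                         ∎
  where
  i = 2 ^ N
  insertD-below : ∀ μ → allBelow (suc N) (insertD i μ) ≡ allBelow (suc N) μ
  insertD-below μ = allBelow-cong (suc N) (suc N)
    (λ all → All.tail (↭.All-resp-↭ (insertD-↭ i μ) all))
    (λ all → ↭.All-resp-↭ (↭-sym (insertD-↭ i μ)) (2^N<2^[1+N] N ∷ all))
  without-i : ∀ {z} → z ∈ B∌ i (i + n) → allBelow (suc N) z ≡ allBelow N z
  without-i {z} z∈ with ∈-filter⁻ (¬? ∘ (i ∈?_)) {xs = B (i + n)} z∈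
  ... | z∈B , i∉z = allBelow-cong (suc N) N
    (λ all → All.tabulate (λ x∈z → below-2^N (All.lookup powers x∈z) x∈z (All.lookup all x∈z)))
    (All.map (λ x<2^N → <-trans x<2^N (2^N<2^[1+N] N)))
    where
    open BinaryPartition (∈B⁻ {i + n} z∈B)
    below-2^N : ∀ {x} → Pow2 x → x ∈ z → x < 2 ^ suc N → x < 2 ^ N
    below-2^N (a , refl) x∈z x<2^[1+N] with 2^-cancel-< a (suc N) x<2^[1+N]
    ... | s≤s a≤N with m≤n⇒m<n∨m≡n a≤N
    ...   | inj₁ a<N  = ^-monoʳ-< 2 (s≤s (s≤s z≤n)) a<N
    ...   | inj₂ refl = ⊥-elim (i∉z x∈z)
  with-i : ∀ {z} → z ∈ B (i + n) → ¬ ¬ i ∈ z → allBelow N z ≡ 0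
  with-i _ ¬i∉z = allBelow-no N (λ all → ¬i∉z (λ i∈z → <-irrefl refl (All.lookup all i∈z)))

prodGeom≡bBelow : ∀ N n → prodGeom N n ≡ bBelow N n
prodGeom≡bBelow zero    n = sym (bBelow-zero n)
prodGeom≡bBelow (suc N) n = trans (⊛-congˡ (geom (2 ^ N)) (prodGeom≡bBelow N) n)
  (recurrence-unique (2 ^ N) {{m^n≢0 2 N}} initial (⊛-geom-+ (bBelow N) (2 ^ N) {{m^n≢0 2 N}})
     (λ m → trans (bBelow-suc-+ N m) (+-comm _ (bBelow (suc N) m))) n)
  where
  initial : ∀ {m} → m < 2 ^ N → (bBelow N ⊛ geom (2 ^ N)) m ≡ bBelow (suc N) m
  initial m<2^N = trans (⊛-geom-< (bBelow N) (2 ^ N) m<2^N)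
    (trans (bBelow-large N m<2^N) (sym (bBelow-large (suc N) (<-trans m<2^N (2^N<2^[1+N] N)))))

prodBinary≡b : ∀ n → prodBinary n ≡ b n
prodBinary≡b n = trans (prodGeom≡bBelow (suc n) n) (bBelow-large (suc n) (<-trans (n<2^n n) (2^N<2^[1+N] n)))

-- Closed forms

Bshift-≤ : ∀ {n j} → j ≤ n → Bshift n j ≡ b (n ∸ j)
Bshift-≤ {n} {j} j≤n with j ≤ᵇ n in j≤ᵇn
... | true  = refl
... | false = ⊥-elim (subst T j≤ᵇn (≤⇒≤ᵇ j≤n))

Bshift-> : ∀ {n j} → n < j → Bshift n j ≡ 0
Bshift-> {n} {j} n<j with j ≤ᵇ n in j≤ᵇn
... | false = refl
... | true  = ⊥-elim (<⇒≱ n<j (≤ᵇ⇒≤ j n (subst T (sym j≤ᵇn) _)))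

Bshift-+ : ∀ a n j → Bshift (a + n) (a + j) ≡ Bshift n j
Bshift-+ a n j with j ≤? n
... | yes j≤n = begin
  Bshift (a + n) (a + j)   ≡⟨ Bshift-≤ (+-monoʳ-≤ a j≤n) ⟩
  b (a + n ∸ (a + j))      ≡⟨ cong b ([m+n]∸[m+o]≡n∸o a n j) ⟩
  b (n ∸ j)                ≡⟨ Bshift-≤ j≤n ⟨
  Bshift n j               ∎
... | no  j≰n = trans (Bshift-> (+-monoʳ-< a (≰⇒> j≰n))) (sym (Bshift-> (≰⇒> j≰n)))

-- The two sums in (b) are ∑wB 2 w₁ n and ∑wB 1 w₂ n (w₁, w₂ below).
∑wB : ℕ → (ℕ → ℕ) → ℕ → ℕ
∑wB a w n = ∑[ k < suc n ] w k * Bshift n (a * k)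

∑wB-cong : ∀ a {w v} n → (∀ k → w k ≡ v k) → ∑wB a w n ≡ ∑wB a v n
∑wB-cong a n w≡v = ∑<-cong (suc n) (λ {k} _ → cong (_* Bshift n (a * k)) (w≡v k))

∑wB-+ : ∀ a w v n → ∑wB a (λ k → w k + v k) n ≡ ∑wB a w n + ∑wB a v n
∑wB-+ a w v n = trans (∑<-cong (suc n) (λ {k} _ → *-distribʳ-+ (Bshift n (a * k)) (w k) (v k)))
                      (∑<-+ (suc n) (λ k → w k * Bshift n (a * k)) (λ k → v k * Bshift n (a * k)))

∑wB-< : ∀ a w {n} → n < a → ∑wB a w n ≡ w 0 * b n
∑wB-< a w {n} n<a = begin
  w 0 * Bshift n (a * 0) + (∑[ k < n ] w (suc k) * Bshift n (a * suc k))
      ≡⟨ cong₂ _+_ (cong (λ j → w 0 * Bshift n j) (*-zeroʳ a)) (∑<-zero n vanish) ⟩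
  w 0 * b n + 0
      ≡⟨ +-identityʳ _ ⟩
  w 0 * b n ∎
  where
  vanish : ∀ {k} → k < n → w (suc k) * Bshift n (a * suc k) ≡ 0
  vanish {k} _ = trans (cong (w (suc k) *_) (Bshift-> (<-≤-trans n<a (m≤m*n a (suc k))))) (*-zeroʳ (w (suc k)))

∑wB-+a : ∀ a .{{_ : NonZero a}} w n → ∑wB a w (a + n) ≡ w 0 * b (a + n) + ∑wB a (w ∘ suc) n
∑wB-+a a w n = begin
  w 0 * Bshift (a + n) (a * 0) + (∑[ k < a + n ] w (suc k) * Bshift (a + n) (a * suc k))
      ≡⟨ cong₂ _+_ (cong (λ j → w 0 * Bshift (a + n) j) (*-zeroʳ a)) (∑<-cong (a + n) (λ {k} _ → shift k)) ⟩
  w 0 * b (a + n) + (∑[ k < a + n ] w (suc k) * Bshift n (a * k))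
      ≡⟨ cong (w 0 * b (a + n) +_) (∑<-truncate _ (+-monoˡ-≤ n (>-nonZero⁻¹ a)) vanish) ⟩
  w 0 * b (a + n) + ∑wB a (w ∘ suc) n ∎
  where
  shift : ∀ k → w (suc k) * Bshift (a + n) (a * suc k) ≡ w (suc k) * Bshift n (a * k)
  shift k = cong (w (suc k) *_) (trans (cong (Bshift (a + n)) (*-suc a k)) (Bshift-+ a n (a * k)))
  vanish : ∀ {k} → suc n ≤ k → w (suc k) * Bshift n (a * k) ≡ 0
  vanish {k} n<k = trans (cong (w (suc k) *_) (Bshift-> (<-≤-trans n<k (m≤n*m k a)))) (*-zeroʳ (w (suc k)))

∑wB-+a-vanishing : ∀ a .{{_ : NonZero a}} w n → w 0 ≡ 0 → ∑wB a w (a + n) ≡ ∑wB a (w ∘ suc) n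
∑wB-+a-vanishing a w n w0≡0 = trans (∑wB-+a a w n) (cong (λ x → x * b (a + n) + ∑wB a (w ∘ suc) n) w0≡0)

spread : (ℕ → ℕ) → ℕ → ℕ
spread w zero          = w 0
spread w (suc zero)    = 0
spread w (suc (suc j)) = spread (w ∘ suc) j

spread-cong : ∀ {w v} n → (∀ k → w k ≡ v k) → spread w n ≡ spread v n
spread-cong zero          w≡v = w≡v 0
spread-cong (suc zero)    w≡v = refl
spread-cong (suc (suc n)) w≡v = spread-cong n (w≡v ∘ suc)

spread-+ : ∀ w v n → spread (λ k → w k + v k) n ≡ spread w n + spread v n
spread-+ w v zero          = refl
spread-+ w v (suc zero)    = refl
spread-+ w v (suc (suc n)) = spread-+ (w ∘ suc) (v ∘ suc) n

∑wB-spread : ∀ w n → ∑wB 2 w n ≡ ∑wB 1 (spread w) n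
∑wB-spread w zero          = trans (∑wB-< 2 w (s≤s z≤n)) (sym (∑wB-< 1 (spread w) (s≤s z≤n)))
∑wB-spread w (suc zero)    = begin
  ∑wB 2 w 1                                   ≡⟨ ∑wB-< 2 w (s≤s (s≤s z≤n)) ⟩
  w 0 * b 1                                   ≡⟨ +-identityʳ _ ⟨
  w 0 * b 1 + 0 * b 0                         ≡⟨ cong (w 0 * b 1 +_) (∑wB-< 1 (spread w ∘ suc) (s≤s z≤n)) ⟨
  w 0 * b 1 + ∑wB 1 (spread w ∘ suc) 0        ≡⟨ ∑wB-+a 1 (spread w) 0 ⟨
  ∑wB 1 (spread w) 1                          ∎
∑wB-spread w (suc (suc n)) = begin
  ∑wB 2 w (2 + n)                                        ≡⟨ ∑wB-+a 2 w n ⟩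
  w 0 * b (2 + n) + ∑wB 2 (w ∘ suc) n                    ≡⟨ cong (w 0 * b (2 + n) +_) (∑wB-spread (w ∘ suc) n) ⟩
  w 0 * b (2 + n) + ∑wB 1 (spread (w ∘ suc)) n           ≡⟨ cong (w 0 * b (2 + n) +_) (∑wB-+a-vanishing 1 (spread w ∘ suc) n refl) ⟨
  w 0 * b (2 + n) + ∑wB 1 (spread w ∘ suc) (1 + n)       ≡⟨ ∑wB-+a 1 (spread w) (1 + n) ⟨
  ∑wB 1 (spread w) (2 + n)                               ∎

positive : ℕ → ℕ
positive zero    = 0
positive (suc _) = 1

∑wB-const-1 : ∀ a n → ∑wB a (λ _ → 1) n ≡ b n + ∑wB a positive n
∑wB-const-1 a n = cong₂ _+_ (trans (cong (λ j → 1 * Bshift n j) (*-zeroʳ a)) (*-identityˡ (b n))) refl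

∑wB-positive-+a : ∀ a .{{_ : NonZero a}} n → ∑wB a positive (a + n) ≡ ∑wB a positive n + b n
∑wB-positive-+a a n = begin
  ∑wB a positive (a + n)   ≡⟨ ∑wB-+a-vanishing a positive n refl ⟩
  ∑wB a (λ _ → 1) n        ≡⟨ ∑wB-const-1 a n ⟩
  b n + ∑wB a positive n   ≡⟨ +-comm (b n) _ ⟩
  ∑wB a positive n + b n   ∎

multSet-B≡∑wB-positive : ∀ {i} → Pow2 i → ∀ n → multSet i (B n) ≡ ∑wB i positive n
multSet-B≡∑wB-positive {i} pow2 =
  recurrence-unique i {{i≢0}} (λ n<i → trans (multSet-B-< n<i) (sym (∑wB-< i positive n<i))) (λ n → multSet-B-+ n pow2) (λ n → ∑wB-positive-+a i {{i≢0}} n)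
  where
  i≢0 = >-nonZero (Pow2⇒pos pow2)

w₁ w₂ : ℕ → ℕ
w₁ i = if 2 ≤ᵇ i then i ∸ 1 else 0
w₂ i = if 4 ≤ᵇ i then ceilQuarter i else 0

w₁-suc : ∀ k → w₁ (suc k) ≡ w₁ k + positive k
w₁-suc zero          = refl
w₁-suc (suc zero)    = refl
w₁-suc (suc (suc k)) = +-comm 1 (suc k)

w₁-+2 : ∀ k → w₁ (2 + k) ≡ w₁ k + suc (positive k)
w₁-+2 zero          = refl
w₁-+2 (suc zero)    = refl
w₁-+2 (suc (suc k)) = +-comm 2 (suc k)

w₂-+4 : ∀ k → w₂ (4 + k) ≡ w₂ k + positive k
w₂-+4 0 = refl
w₂-+4 1 = refl
w₂-+4 2 = refl
w₂-+4 3 = refl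
w₂-+4 k@(suc (suc (suc (suc j)))) = trans (m/n≡1+[m∸n]/n {k + 3} {4} (s≤s (s≤s (s≤s (s≤s z≤n))))) (+-comm 1 _)

∑m₂C2≡∑wB : ∀ n → ∑m₂C2 n ≡ ∑wB 2 w₁ n
∑m₂C2≡∑wB = recurrence-unique 2 initial ∑m₂C2-+2 closed-form-+2
  where
  initial : ∀ {n} → n < 2 → ∑m₂C2 n ≡ ∑wB 2 w₁ n
  initial {0} _ = refl
  initial {1} _ = refl
  initial {2+ _} (s≤s (s≤s ()))
  closed-form-+2 : ∀ n → ∑wB 2 w₁ (2 + n) ≡ ∑wB 2 w₁ n + multSet 2 (B n)
  closed-form-+2 n = begin
    ∑wB 2 w₁ (2 + n)                        ≡⟨ ∑wB-+a-vanishing 2 w₁ n refl ⟩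
    ∑wB 2 (w₁ ∘ suc) n                      ≡⟨ ∑wB-cong 2 n w₁-suc ⟩
    ∑wB 2 (λ k → w₁ k + positive k) n       ≡⟨ ∑wB-+ 2 w₁ positive n ⟩
    ∑wB 2 w₁ n + ∑wB 2 positive n           ≡⟨ cong (∑wB 2 w₁ n +_) (multSet-B≡∑wB-positive (1 , refl) n) ⟨
    ∑wB 2 w₁ n + multSet 2 (B n)            ∎

∑m₁m₄≡∑wB : ∀ n → ∑m₁m₄ n ≡ ∑wB 1 w₂ n
∑m₁m₄≡∑wB = recurrence-unique 4 initial ∑m₁m₄-+4 closed-form-+4
  where
  initial : ∀ {n} → n < 4 → ∑m₁m₄ n ≡ ∑wB 1 w₂ n
  initial {0} _ = refl
  initial {1} _ = refl
  initial {2} _ = refl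
  initial {3} _ = refl
  initial {2+ (2+ _)} (s≤s (s≤s (s≤s (s≤s ()))))
  closed-form-+4 : ∀ n → ∑wB 1 w₂ (4 + n) ≡ ∑wB 1 w₂ n + multSet 1 (B n)
  closed-form-+4 n = begin
    ∑wB 1 w₂ (4 + n)                        ≡⟨ ∑wB-+a-vanishing 1 w₂ (3 + n) refl ⟩
    ∑wB 1 (λ k → w₂ (1 + k)) (3 + n)        ≡⟨ ∑wB-+a-vanishing 1 (λ k → w₂ (1 + k)) (2 + n) refl ⟩
    ∑wB 1 (λ k → w₂ (2 + k)) (2 + n)        ≡⟨ ∑wB-+a-vanishing 1 (λ k → w₂ (2 + k)) (1 + n) refl ⟩
    ∑wB 1 (λ k → w₂ (3 + k)) (1 + n)        ≡⟨ ∑wB-+a-vanishing 1 (λ k → w₂ (3 + k)) n refl ⟩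
    ∑wB 1 (λ k → w₂ (4 + k)) n              ≡⟨ ∑wB-cong 1 n w₂-+4 ⟩
    ∑wB 1 (λ k → w₂ k + positive k) n       ≡⟨ ∑wB-+ 1 w₂ positive n ⟩
    ∑wB 1 w₂ n + ∑wB 1 positive n           ≡⟨ cong (∑wB 1 w₂ n +_) (multSet-B≡∑wB-positive (0 , refl) n) ⟨
    ∑wB 1 w₂ n + multSet 1 (B n)            ∎

c≡∑wB : ∀ n → c n ≡ ∑wB 1 w₂ n + ∑wB 2 w₁ n
c≡∑wB n = begin
  c n                           ≡⟨ c≡∑m₁m₄+∑m₂C2 n ⟩
  ∑m₁m₄ n + ∑m₂C2 n             ≡⟨ cong₂ _+_ (∑m₁m₄≡∑wB n) (∑m₂C2≡∑wB n) ⟩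
  ∑wB 1 w₂ n + ∑wB 2 w₁ n       ∎

rhsB≡∑wB : ∀ n → rhsB n ≡ ∑wB 1 w₂ n + ∑wB 2 w₁ n
rhsB≡∑wB n = trans (cong₂ _+_ first second) (+-comm (∑wB 2 w₁ n) (∑wB 1 w₂ n))
  where
  first : sum (map (λ i → if 2 ≤ᵇ i then (i ∸ 1) * Bshift n (2 * i) else 0) (upTo (suc n))) ≡ ∑wB 2 w₁ n
  first = trans (sum-map-upTo (λ i → if 2 ≤ᵇ i then (i ∸ 1) * Bshift n (2 * i) else 0) (suc n)) (∑<-cong (suc n) (λ {i} _ → if-then-* (2 ≤ᵇ i) (i ∸ 1) (Bshift n (2 * i))))
  second : sum (map (λ i → if 4 ≤ᵇ i then ceilQuarter i * Bshift n i else 0) (upTo (suc n))) ≡ ∑wB 1 w₂ n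
  second = trans (sum-map-upTo (λ i → if 4 ≤ᵇ i then ceilQuarter i * Bshift n i else 0) (suc n)) (∑<-cong (suc n) (λ {i} _ →
             trans (if-then-* (4 ≤ᵇ i) (ceilQuarter i) (Bshift n i)) (cong (λ j → w₂ i * Bshift n j) (sym (*-identityˡ i)))))

-- W k is the weight of |𝓑(n − k)| in (b): w₂ k from the second sum, w₁ (k / 2) from the first for even k.
U V W : Series
U = numer ⊛ geom 2
V = U ⊛ geom 4
W k = w₂ k + spread w₁ k

U-+4 : ∀ n → U (4 + n) ≡ positive n + spread (suc ∘ positive) n
U-+4 0 = refl
U-+4 1 = refl
U-+4 (suc (suc m)) = begin
  U (6 + m)                                                  ≡⟨ ⊛-geom-+ numer 2 (4 + m) ⟩
  U (4 + m) + numer (6 + m)                                  ≡⟨ +-comm (U (4 + m)) (numer (6 + m)) ⟩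
  numer (6 + m) + U (4 + m)                                  ≡⟨ cong (numer (6 + m) +_) (U-+4 m) ⟩
  numer (6 + m) + (positive m + spread (suc ∘ positive) m)   ≡⟨ step m ⟩
  positive (2 + m) + spread (suc ∘ positive) (2 + m)         ∎
  where
  step : ∀ m → numer (6 + m) + (positive m + spread (suc ∘ positive) m) ≡ positive (2 + m) + spread (suc ∘ positive) (2 + m)
  step 0             = refl
  step 1             = refl
  step (suc (suc _)) = refl

W-+4 : ∀ n → W (4 + n) ≡ W n + U (4 + n)
W-+4 n = begin
  w₂ (4 + n) + spread (w₁ ∘ suc ∘ suc) n                         ≡⟨ cong₂ _+_ (w₂-+4 n) (spread-cong n w₁-+2) ⟩
  w₂ n + positive n + spread (λ k → w₁ k + suc (positive k)) n   ≡⟨ cong (w₂ n + positive n +_) (spread-+ w₁ (suc ∘ positive) n) ⟩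
  w₂ n + positive n + (spread w₁ n + spread (suc ∘ positive) n)  ≡⟨ +-interchange (w₂ n) (positive n) (spread w₁ n) _ ⟩
  W n + (positive n + spread (suc ∘ positive) n)                 ≡⟨ cong (W n +_) (U-+4 n) ⟨
  W n + U (4 + n)                                                ∎

V≡W : ∀ n → V n ≡ W n
V≡W = recurrence-unique 4 initial (⊛-geom-+ U 4) W-+4
  where
  initial : ∀ {n} → n < 4 → V n ≡ W n
  initial {0} _ = refl
  initial {1} _ = refl
  initial {2} _ = refl
  initial {3} _ = refl
  initial {2+ (2+ _)} (s≤s (s≤s (s≤s (s≤s ()))))

rhsA≡∑wB : ∀ n → rhsA n ≡ ∑wB 1 w₂ n + ∑wB 2 w₁ n
rhsA≡∑wB n = begin
  (V ⊛ prodBinary) n                                ≡⟨ ⊛-∑ V prodBinary n ⟩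
  ∑[ i < suc n ] V i * prodBinary (n ∸ i)           ≡⟨ ∑<-cong (suc n) (λ {i} i<1+n → cong₂ _*_ (V≡W i) (coefficient i<1+n)) ⟩
  ∑wB 1 W n                                         ≡⟨ ∑wB-+ 1 w₂ (spread w₁) n ⟩
  ∑wB 1 w₂ n + ∑wB 1 (spread w₁) n                  ≡⟨ cong (∑wB 1 w₂ n +_) (∑wB-spread w₁ n) ⟨
  ∑wB 1 w₂ n + ∑wB 2 w₁ n                           ∎
  where
  coefficient : ∀ {i} → i < suc n → prodBinary (n ∸ i) ≡ Bshift n (1 * i)
  coefficient {i} i<1+n = begin
    prodBinary (n ∸ i)  ≡⟨ prodBinary≡b (n ∸ i) ⟩
    b (n ∸ i)           ≡⟨ Bshift-≤ (s≤s⁻¹ i<1+n) ⟨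
    Bshift n i          ≡⟨ cong (Bshift n) (*-identityˡ i) ⟨
    Bshift n (1 * i)    ∎

-- The difference Δc

2∣sum : ∀ {z} → All Pow2 z → 1 ∉ z → 2 ∣ sum z
2∣sum []                       _   = divides 0 refl
2∣sum ((zero  , refl) ∷ pows) 1∉z = ⊥-elim (1∉z (here refl))
2∣sum ((suc a , refl) ∷ pows) 1∉z =
  ∣m∣n⇒∣m+n (divides (2 ^ a) (*-comm 2 (2 ^ a))) (2∣sum pows (1∉z ∘ there))

-- A binary partition of an odd number has a part 1; removing it is a bijection onto 𝓑(n).
b-odd : ∀ n → ¬ 2 ∣ suc n → b (suc n) ≡ b n
b-odd n 2∤1+n = begin
  b (1 + n)                             ≡⟨ ∑B-const-1 (1 + n) ⟨
  ∑B (1 + n) (λ _ → 1)                  ≡⟨ sum-map-filter-vanishing (1 ∈?_) (λ _ → 1) (B (1 + n)) has-1 ⟩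
  sum (map (λ _ → 1) (B∋ 1 (1 + n)))    ≡⟨ sum-map-B∋ n (λ _ → 1) (0 , refl) ⟩
  ∑B n (λ _ → 1)                        ≡⟨ ∑B-const-1 n ⟩
  b n                                   ∎
  where
  has-1 : ∀ {z} → z ∈ B (1 + n) → 1 ∉ z → 1 ≡ 0
  has-1 z∈B 1∉z = ⊥-elim (2∤1+n (subst (2 ∣_) sum≡ (2∣sum powers 1∉z)))
    where open BinaryPartition (∈B⁻ {1 + n} z∈B)

isOdd-+2 : ∀ n → isOdd (2 + n) ≡ isOdd n
isOdd-+2 n = cong (_≡ᵇ 1) (trans (cong (_% 2) (+-comm 2 n)) ([m+n]%n≡m%n n 2))

isOdd-even : ∀ {n} → 2 ∣ n → isOdd n ≡ false
isOdd-even {n} 2∣n = cong (_≡ᵇ 1) (n∣m⇒m%n≡0 n 2 2∣n)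

isOdd-odd : ∀ {n} → ¬ 2 ∣ n → isOdd n ≡ true
isOdd-odd {n} 2∤n with n % 2 | m%n<n n 2 | m%n≡0⇒n∣m n 2
... | 0    | _             | 2∣n = ⊥-elim (2∤n (2∣n refl))
... | 1    | _             | _   = refl
... | 2+ _ | s≤s (s≤s ())  | _

b-step : ∀ n → δ (isOdd n) * b n + b (1 + n) ≡ b n + δ (isOdd n) * b (2 + n)
b-step n with 2 ∣? n
... | yes 2∣n rewrite isOdd-even 2∣n = trans (b-odd n 2∤1+n) (sym (+-identityʳ (b n)))
  where
  2∤1+n : ¬ 2 ∣ suc n
  2∤1+n 2∣1+n = <⇒≱ (s≤s (s≤s z≤n)) (∣⇒≤ (∣m+n∣m⇒∣n (subst (2 ∣_) (+-comm 1 n) 2∣1+n) 2∣n))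
... | no 2∤n rewrite isOdd-odd 2∤n = cong₂ _+_ (+-identityʳ (b n)) (trans (sym (b-odd (1 + n) 2∤2+n)) (sym (+-identityʳ _)))
  where
  2∤2+n : ¬ 2 ∣ 2 + n
  2∤2+n 2∣2+n = 2∤n (∣m+n∣m⇒∣n 2∣2+n ∣-refl)

multSet2-suc : ∀ n → multSet 2 (B (suc n)) ≡ multSet 2 (B n) + δ (isOdd n) * b n
multSet2-suc = recurrence-unique 2 initial (λ n → multSet-B-+ (suc n) (1 , refl)) step
  where
  initial : ∀ {n} → n < 2 → multSet 2 (B (suc n)) ≡ multSet 2 (B n) + δ (isOdd n) * b n
  initial {0} _ = refl
  initial {1} _ = refl
  initial {2+ _} (s≤s (s≤s ()))
  step : ∀ n → multSet 2 (B (2 + n)) + δ (isOdd (2 + n)) * b (2 + n) ≡ multSet 2 (B n) + δ (isOdd n) * b n + b (suc n)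
  step n = begin
    multSet 2 (B (2 + n)) + δ (isOdd (2 + n)) * b (2 + n)  ≡⟨ cong₂ (λ m o → m + δ o * b (2 + n)) (multSet-B-+ n (1 , refl)) (isOdd-+2 n) ⟩
    multSet 2 (B n) + b n + δ (isOdd n) * b (2 + n)         ≡⟨ +-assoc (multSet 2 (B n)) (b n) _ ⟩
    multSet 2 (B n) + (b n + δ (isOdd n) * b (2 + n))       ≡⟨ cong (multSet 2 (B n) +_) (b-step n) ⟨
    multSet 2 (B n) + (δ (isOdd n) * b n + b (1 + n))       ≡⟨ +-assoc (multSet 2 (B n)) _ (b (1 + n)) ⟨
    multSet 2 (B n) + δ (isOdd n) * b n + b (suc n)         ∎

∑m₂C2-suc : ∀ n → ∑m₂C2 (suc n) ≡ ∑m₂C2 n + δ (isOdd n) * multSet 2 (B n)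
∑m₂C2-suc = recurrence-unique 2 initial (λ n → ∑m₂C2-+2 (suc n)) step
  where
  initial : ∀ {n} → n < 2 → ∑m₂C2 (suc n) ≡ ∑m₂C2 n + δ (isOdd n) * multSet 2 (B n)
  initial {0} _ = refl
  initial {1} _ = refl
  initial {2+ _} (s≤s (s≤s ()))
  regroup : ∀ y m d k → y + m + d * (m + k) ≡ y + d * m + (m + d * k)
  regroup = solve-∀
  step : ∀ n → ∑m₂C2 (2 + n) + δ (isOdd (2 + n)) * multSet 2 (B (2 + n))
             ≡ ∑m₂C2 n + δ (isOdd n) * multSet 2 (B n) + multSet 2 (B (suc n))
  step n = begin
    ∑m₂C2 (2 + n) + δ (isOdd (2 + n)) * multSet 2 (B (2 + n))
      ≡⟨ cong₂ (λ y o → y + δ o * multSet 2 (B (2 + n))) (∑m₂C2-+2 n) (isOdd-+2 n) ⟩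
    ∑m₂C2 n + multSet 2 (B n) + δ (isOdd n) * multSet 2 (B (2 + n))
      ≡⟨ cong (λ m → ∑m₂C2 n + multSet 2 (B n) + δ (isOdd n) * m) (multSet-B-+ n (1 , refl)) ⟩
    ∑m₂C2 n + multSet 2 (B n) + δ (isOdd n) * (multSet 2 (B n) + b n)
      ≡⟨ regroup (∑m₂C2 n) (multSet 2 (B n)) (δ (isOdd n)) (b n) ⟩
    ∑m₂C2 n + δ (isOdd n) * multSet 2 (B n) + (multSet 2 (B n) + δ (isOdd n) * b n)
      ≡⟨ cong (∑m₂C2 n + δ (isOdd n) * multSet 2 (B n) +_) (multSet2-suc n) ⟨
    ∑m₂C2 n + δ (isOdd n) * multSet 2 (B n) + multSet 2 (B (suc n)) ∎

∑m₁m₄-suc : ∀ n → ∑m₁m₄ (suc n) ≡ ∑m₁m₄ n + multSet 4 (B n)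
∑m₁m₄-suc = recurrence-unique 4 initial (λ n → ∑m₁m₄-+4 (suc n)) step
  where
  initial : ∀ {n} → n < 4 → ∑m₁m₄ (suc n) ≡ ∑m₁m₄ n + multSet 4 (B n)
  initial {0} _ = refl
  initial {1} _ = refl
  initial {2} _ = refl
  initial {3} _ = refl
  initial {2+ (2+ _)} (s≤s (s≤s (s≤s (s≤s ()))))
  regroup : ∀ x m₁ m₄ k → x + m₁ + (m₄ + k) ≡ x + m₄ + (m₁ + k)
  regroup = solve-∀
  step : ∀ n → ∑m₁m₄ (4 + n) + multSet 4 (B (4 + n)) ≡ ∑m₁m₄ n + multSet 4 (B n) + multSet 1 (B (suc n))
  step n = begin
    ∑m₁m₄ (4 + n) + multSet 4 (B (4 + n))                      ≡⟨ cong₂ _+_ (∑m₁m₄-+4 n) (multSet-B-+ n (2 , refl)) ⟩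
    ∑m₁m₄ n + multSet 1 (B n) + (multSet 4 (B n) + b n)        ≡⟨ regroup (∑m₁m₄ n) (multSet 1 (B n)) (multSet 4 (B n)) (b n) ⟩
    ∑m₁m₄ n + multSet 4 (B n) + (multSet 1 (B n) + b n)        ≡⟨ cong (∑m₁m₄ n + multSet 4 (B n) +_) (multSet-B-+ n (0 , refl)) ⟨
    ∑m₁m₄ n + multSet 4 (B n) + multSet 1 (B (suc n))          ∎

c-suc : ∀ n → c (suc n) ≡ c n + (multSet 4 (B n) + δ (isOdd n) * multSet 2 (B n))
c-suc n = begin
  c (suc n)                                                                  ≡⟨ c≡∑m₁m₄+∑m₂C2 (suc n) ⟩
  ∑m₁m₄ (suc n) + ∑m₂C2 (suc n)                                              ≡⟨ cong₂ _+_ (∑m₁m₄-suc n) (∑m₂C2-suc n) ⟩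
  ∑m₁m₄ n + multSet 4 (B n) + (∑m₂C2 n + δ (isOdd n) * multSet 2 (B n))      ≡⟨ +-interchange (∑m₁m₄ n) _ (∑m₂C2 n) _ ⟩
  ∑m₁m₄ n + ∑m₂C2 n + (multSet 4 (B n) + δ (isOdd n) * multSet 2 (B n))      ≡⟨ cong (_+ (multSet 4 (B n) + δ (isOdd n) * multSet 2 (B n))) (c≡∑m₁m₄+∑m₂C2 n) ⟨
  c n + (multSet 4 (B n) + δ (isOdd n) * multSet 2 (B n))                    ∎

length-positions : ∀ i z → length (positions i z) ≡ mult i z
length-positions i z = trans (length-map proj₁ (filter at-i (zip (upTo (length z)) z)))
                             (go (upTo (length z)) z (≤-reflexive (sym (length-upTo (length z)))))
  where
  at-i : ∀ (px : ℕ × ℕ) → Dec (proj₂ px ≡ i)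
  at-i (_ , x) = x ≟ i
  go : ∀ (ps z : List ℕ) → length z ≤ length ps → length (filter at-i (zip ps z)) ≡ mult i z
  go []       []      _         = refl
  go (_ ∷ _)  []      _         = refl
  go (p ∷ ps) (x ∷ z) (s≤s len) with x ≟ i
  ... | yes x≡i = begin
    length (filter at-i ((p , x) ∷ zip ps z))  ≡⟨ cong length (filter-accept at-i {p , x} x≡i) ⟩
    suc (length (filter at-i (zip ps z)))      ≡⟨ cong suc (go ps z len) ⟩
    suc (mult i z)                             ≡⟨ mult-∷-≡ z x≡i ⟨
    mult i (x ∷ z)                             ∎
  ... | no x≢i = begin
    length (filter at-i ((p , x) ∷ zip ps z))  ≡⟨ cong length (filter-reject at-i {p , x} x≢i) ⟩
    length (filter at-i (zip ps z))            ≡⟨ go ps z len ⟩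
    mult i z                                   ≡⟨ mult-∷-≢ z x≢i ⟨
    mult i (x ∷ z)                             ∎

length-BR : ∀ i n → length (BR i n) ≡ multSet i (B n)
length-BR i n = trans (length-concatMap _ (B n))
  (sum-map-cong (B n) (λ {z} _ → trans (length-map _ (positions i z)) (length-positions i z)))
  where
  length-concatMap : ∀ {A C : Set} (f : A → List C) xs → length (concatMap f xs) ≡ sum (map (length ∘ f) xs)
  length-concatMap f []       = refl
  length-concatMap f (x ∷ xs) = trans (length-++ (f x)) (cong (length (f x) +_) (length-concatMap f xs))

open import Data.Integer using (+_; _-_; _⊖_)
import Data.Integer.Properties as ℤ

+[m+n]-+m≡+n : ∀ m n → + (m + n) - + m ≡ + n
+[m+n]-+m≡+n m n = begin
  + (m + n) - + m     ≡⟨ ℤ.[+m]-[+n]≡m⊖n (m + n) m ⟩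
  (m + n) ⊖ m         ≡⟨ ℤ.⊖-≥ (m≤m+n m n) ⟩
  + (m + n ∸ m)       ≡⟨ cong +_ (m+n∸m≡n m n) ⟩
  + n                 ∎

theorem2p5 : ((n : ℕ) → cSeries n ≡ rhsA n)
           × ((n : ℕ) → c n ≡ rhsB n)
           × ((n : ℕ) → (+ c (suc n)) - (+ c n) ≡ + (length (BR 4 n) + δ (isOdd n) * length (BR 2 n)))
theorem2p5 = part-a , part-b , part-c
  where
  part-a : ∀ n → cSeries n ≡ rhsA n
  part-a n = trans (c≡∑wB n) (sym (rhsA≡∑wB n))
  part-b : ∀ n → c n ≡ rhsB n
  part-b n = trans (c≡∑wB n) (sym (rhsB≡∑wB n))
  part-c : ∀ n → (+ c (suc n)) - (+ c n) ≡ + (length (BR 4 n) + δ (isOdd n) * length (BR 2 n))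
  part-c n = begin
    + c (suc n) - + c n                                          ≡⟨ cong (λ m → + m - + c n) (c-suc n) ⟩
    + (c n + (multSet 4 (B n) + δ (isOdd n) * multSet 2 (B n))) - + c n ≡⟨ +[m+n]-+m≡+n (c n) _ ⟩
    + (multSet 4 (B n) + δ (isOdd n) * multSet 2 (B n))          ≡⟨ cong₂ (λ p q → + (p + δ (isOdd n) * q)) (length-BR 4 n) (length-BR 2 n) ⟨
    + (length (BR 4 n) + δ (isOdd n) * length (BR 2 n))          ∎
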